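{- Let $\mathbb{K}$ be a finite field of cardinality $q$ and characteristic different from $2$. There are at least $\frac{q-1}{2}$ elements $u\in\mathbb{K}^*$ for which the $u$-trinomial minimal solution of $(E_{\mathbb{K}})$ is irreducible. If $\mathbb{K}=\mathbb{Z}/p\mathbb{Z}$ with $p$ prime and $p\equiv 3\pmod 4$, there are at least $\frac{p+1}{2}$ elements $u\in\mathbb{K}^*$ for which the $u$-trinomial minimal solution of $(E_{\mathbb{K}})$ is irreducible.
   Context: For a commutative unital ring $A$ and $a_1,\ldots,a_n\in A$ set $M_n(a_1,\ldots,a_n)=\begin{pmatrix} a_n & -1_A\\ 1_A & 0_A\end{pmatrix}\cdots\begin{pmatrix} a_1 & -1_A\\ 1_A & 0_A\end{pmatrix}$. An $n$-tuple is a solution of $(E_A)$ if $M_n(a_1,\ldots,a_n)=\pm \mathrm{Id}$. For tuples, $(a_1,\ldots,a_n)\oplus(b_1,\ldots,b_m)=(a_1+b_m,a_2,\ldots,a_{n-1},a_n+b_1,b_2,\ldots,b_{m-1})$. Write $(a_1,\ldots,a_n)\sim(b_1,\ldots,b_n)$ if $(b_1,\ldots,b_n)$ is obtained from $(a_1,\ldots,a_n)$ or from $(a_n,\ldots,a_1)$ by a cyclic permutation. A solution $(c_1,\ldots,c_n)$ with $n\geq 3$ is reducible if there exist a solution $(b_1,\ldots,b_l)$ and a tuple $(a_1,\ldots,a_m)$ with $l,m\geq 3$ and $(c_1,\ldots,c_n)\sim(a_1,\ldots,a_m)\oplus(b_1,\ldots,b_l)$; otherwise irreducible. For $A$ finite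 and $u$ a unit of $A$, the $u$-trinomial minimal solution of $(E_A)$ is the solution of the form $(u,u^{ -1},u^{ -1},\ldots,u,u^{ -1},u^{ -1})$ (block $(u,u^{ -1},u^{ -1})$ repeated $k\geq1$ times) of minimal size; it exists. -}

module Defs where

open import Level using (Level; _⊔_) renaming (suc to lsuc)
open import Data.Nat as ℕ using (ℕ; zero; suc; _≤_)
open import Data.Fin using (Fin)
open import Data.Integer as ℤ using (ℤ)
open import Data.Integer.Divisibility using () renaming (_∣_ to _∣ℤ_)
open import Data.List using (List; []; _∷_; _++_; length; reverse; drop; take; foldl; concat; replicate)
open import Data.List.Relation.Binary.Pointwise using (Pointwise)
open import Data.List.Relation.Unary.All using (All)
open import Data.List.Relation.Unary.AllPairs using (AllPairs)
open import Relation.Binary.PropositionalEquality using (_≡_)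
open import Data.Product using (Σ; ∃; ∃-syntax; _×_; _,_)
open import Data.Sum using (_⊎_)
open import Relation.Nullary using (¬_)
open import Relation.Binary.Core using (Rel)
open import Relation.Binary.Definitions using (Decidable)
open import Algebra.Bundles using (CommutativeRing)
open import Algebra.Bundles.Raw using (RawRing)

module EA {c ℓ : Level} (A : RawRing c ℓ) where
  open RawRing A

  record Mat : Set c where
    constructor mat
    field
      m11 m12 m21 m22 : Carrier

  _·_ : Mat → Mat → Mat
  mat a b c' d · mat e f g h =
    mat (a * e + b * g) (a * f + b * h) (c' * e + d * g) (c' * f + d * h)

  Id : Mat
  Id = mat 1# 0# 0# 1#

  -Id : Mat
  -Id = mat (- 1#) 0# 0# (- 1#)

  Mᵃ : Carrier → Mat
  Mᵃ a = mat a (- 1#) 1# 0#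

  -- M_n(a_1,...,a_n) = M(a_n) ⋯ M(a_1)
  M : List Carrier → Mat
  M = foldl (λ acc a → Mᵃ a · acc) Id

  _≈M_ : Mat → Mat → Set ℓ
  mat a b c' d ≈M mat e f g h = (a ≈ e) × (b ≈ f) × (c' ≈ g) × (d ≈ h)

  IsSolution : List Carrier → Set ℓ
  IsSolution as = (M as ≈M Id) ⊎ (M as ≈M -Id)

  _≈L_ : List Carrier → List Carrier → Set (c ⊔ ℓ)
  _≈L_ = Pointwise _≈_

  rotate : ℕ → List Carrier → List Carrier
  rotate k xs = drop k xs ++ take k xs

  _∼_ : List Carrier → List Carrier → Set (c ⊔ ℓ)
  as ∼ bs = ∃[ k ] ((rotate k as ≈L bs) ⊎ (rotate k (reverse as) ≈L bs))

  -- (a1 ∷ as ++ [an]) ⊕ (b1 ∷ bs ++ [bm])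
  --   = (a1 + bm , as , an + b1 , bs)
  ⊕-tuple : Carrier → List Carrier → Carrier →
            Carrier → List Carrier → Carrier → List Carrier
  ⊕-tuple a1 as an b1 bs bm = (a1 + bm) ∷ as ++ ((an + b1) ∷ bs)

  -- reducible: c ∼ (a_1..a_m) ⊕ (b_1..b_l), (b_1..b_l) a solution, l,m ≥ 3
  Reducible : List Carrier → Set (c ⊔ ℓ)
  Reducible cs =
    Σ Carrier λ a1 → Σ (List Carrier) λ as → Σ Carrier λ an →
    Σ Carrier λ b1 → Σ (List Carrier) λ bs → Σ Carrier λ bm →
      (1 ≤ length as) × (1 ≤ length bs) ×
      IsSolution (b1 ∷ bs ++ (bm ∷ [])) ×
      (cs ∼ ⊕-tuple a1 as an b1 bs bm)

  Irreducible : List Carrier → Set (c ⊔ ℓ)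
  Irreducible cs = (3 ≤ length cs) × ¬ Reducible cs

  trinomial : Carrier → Carrier → ℕ → List Carrier
  trinomial u v k = concat (replicate k (u ∷ v ∷ v ∷ []))

  IsMinimalTrinomial : Carrier → Carrier → ℕ → Set ℓ
  IsMinimalTrinomial u v k =
    (1 ≤ k) × IsSolution (trinomial u v k) ×
    (∀ j → 1 ≤ j → j ℕ.< k → ¬ IsSolution (trinomial u v j))

  MinTrinomialIrreducible : Carrier → Set (c ⊔ ℓ)
  MinTrinomialIrreducible u =
    ∀ v → u * v ≈ 1# →
      ∃[ k ] (IsMinimalTrinomial u v k × Irreducible (trinomial u v k))

  AtLeastHalfGood : ℕ → Set (c ⊔ ℓ)
  AtLeastHalfGood bound =
    Σ (List Carrier) λ us →
      (bound ≤ 2 ℕ.* length us) ×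
      All (λ u → (¬ u ≈ 0#) × MinTrinomialIrreducible u) us ×
      AllPairs (λ x y → ¬ x ≈ y) us

record IsFiniteField {c ℓ : Level} (K : CommutativeRing c ℓ) (q : ℕ) : Set (c ⊔ ℓ) where
  open CommutativeRing K
  field
    0≉1     : ¬ 0# ≈ 1#
    inverse : ∀ x → ¬ x ≈ 0# → ∃[ y ] (x * y ≈ 1#)
    _≟_     : Decidable _≈_
    enum    : Fin q → Carrier
    enum-injective  : ∀ i j → enum i ≈ enum j → i ≡ j
    enum-surjective : ∀ x → ∃[ i ] (enum i ≈ x)

CharNot2 : {c ℓ : Level} → CommutativeRing c ℓ → Set ℓ
CharNot2 K = ¬ (1# + 1# ≈ 0#)
  where open CommutativeRing K

ℤmod : ℕ → RawRing Level.zero Level.zero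
ℤmod p = record
  { Carrier = ℤ
  ; _≈_ = λ x y → ℤ.+ p ∣ℤ (x ℤ.- y)
  ; _+_ = ℤ._+_
  ; _*_ = ℤ._*_
  ; -_  = ℤ.-_
  ; 0#  = ℤ.0ℤ
  ; 1#  = ℤ.1ℤ
  }

{-# OPTIONS --safe #-}
-- Put a = -u and d = -v = a⁻¹. The matrix of a block (u, v, v) is upper triangular with diagonal
-- (a, d), so k blocks form a solution exactly when aᵏ = ±1, and the minimal trinomial solution
-- exists because a has finite order. A reduction of it would exhibit, inside a rotation of the
-- periodic word uvvuvv…, a window shorter than 3k - 2 letters (the inner part of the solution
-- summand) whose matrix has (1,1) entry ±1. Computing that entry for every window gives 0, ±aᵐ or
-- ±dᵐ with 0 < m < k, impossible by minimality, or d^(j+2) - aʲ, which is ±1 only if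
-- u² + 4 = (u aʲ + v dʲ)² is a square.
--
-- It remains to count the u for which u² + 4 = w² is a square. Then u + w and u - w are nonzero
-- with product -4 and determine u, so u ↦ u + w on all these u, together with u ↦ u - w on those
-- with w ≠ 0, injects into the nonzero elements; w = 0 only at the at most two roots of u² = -4,
-- and at none if -1 is not a square. Hence at most (q + 1)/2 elements are bad, and at most
-- (q - 1)/2 when q ≡ 3 (mod 4), since then multiplication by a square root of -1 would split the
-- nonzero elements into orbits of size 4.
module Submission where

open import Level using (Level; 0ℓ; _⊔_)
open import Algebra.Bundles using (CommutativeRing)
open import Algebra.Bundles.Raw using (RawRing)
open import Data.Nat as ℕ using (ℕ; zero; suc; z≤n; s≤s)
import Data.Nat.Properties as ℕₚ
open import Data.Integer as ℤ using (ℤ)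
import Data.Integer.Properties as ℤₚ
import Data.Sign as Sign
open import Data.Sum as Sum using (_⊎_; inj₁; inj₂)
open import Data.Maybe using (Maybe; just; nothing)
open import Relation.Nullary using (¬_; Dec; yes; no)
open import Function using (_∘_; id)
open import Relation.Binary.PropositionalEquality as ≡ using (_≡_)
import Algebra.Solver.Ring.AlmostCommutativeRing as AlmostCommutativeRing
open import Data.List using (List; []; _∷_; _++_; length; reverse; drop; take; foldl; concat; replicate; map; filter; tabulate; lookup)
import Data.List.Properties as Listₚ
open import Data.List.Relation.Binary.Pointwise using (Pointwise; []; _∷_; Pointwise-length)
open import Data.Product using (∃; ∃₂; _×_; _,_; proj₁; proj₂)
open import Data.Fin as Fin using (Fin; toℕ)
import Data.Fin.Properties as Finₚ
open import Data.List.Relation.Unary.All as All using (All; []; _∷_)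
import Data.List.Relation.Unary.All.Properties as Allₚ
open import Data.List.Relation.Unary.Any as Any using (Any; here; there)
open import Data.List.Relation.Unary.AllPairs using (AllPairs; []; _∷_)
import Data.List.Relation.Unary.AllPairs.Properties as AllPairsₚ
open import Data.List.Membership.Propositional using (_∈_)
import Data.List.Membership.Propositional.Properties as ∈ₚ
open import Relation.Unary using (Pred; Decidable)
import Relation.Nullary.Decidable as Dec
open import Relation.Nullary.Decidable using (¬?; _×-dec_; _⊎-dec_)
import Relation.Binary.Definitions
open import Data.Nat.DivMod using (m≡m%n+[m/n]*n; m%n<n; [m+kn]%n≡m%n)
open import Data.Empty using (⊥-elim)
open import Relation.Binary.Structures using (IsEquivalence)
open import Defs

-- Tactic.RingSolver can only take coefficients in the carrier itself, whose equality is not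
-- decidable here; the image of ℤ lets Algebra.Solver.Ring normalise constants in any commutative ring.
module IntegerCoefficients {c ℓ : Level} (R : CommutativeRing c ℓ) where
  open import Data.Integer using (+_; -[1+_])
  open CommutativeRing R
  open import Algebra.Properties.Ring ring
    using (-0#≈0#; -‿involutive; -‿distribˡ-*; -‿distribʳ-*; -‿+-comm)
  open import Algebra.Properties.Monoid.Mult.TCOptimised +-monoid using (×-homo-+) renaming (_×_ to _×′_)
  open import Algebra.Properties.Semiring.Mult.TCOptimised semiring using (×1-homo-*)
  open import Relation.Binary.Reasoning.Setoid setoid

  ⟦_⟧ : ℤ → Carrier
  ⟦ + n ⟧      = n ×′ 1#
  ⟦ -[1+ n ] ⟧ = - (suc n ×′ 1#)

  private
    x-y≈[z+x]-[z+y] : ∀ x y z → x - y ≈ (z + x) - (z + y)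
    x-y≈[z+x]-[z+y] x y z = begin
      x - y                    ≈⟨ +-congʳ (+-identityˡ x) ⟨
      (0# + x) - y             ≈⟨ +-congʳ (+-congʳ (-‿inverseʳ z)) ⟨
      ((z - z) + x) - y        ≈⟨ +-congʳ (+-assoc z (- z) x) ⟩
      (z + (- z + x)) - y      ≈⟨ +-congʳ (+-congˡ (+-comm (- z) x)) ⟩
      (z + (x - z)) - y        ≈⟨ +-congʳ (+-assoc z x (- z)) ⟨
      ((z + x) - z) - y        ≈⟨ +-assoc (z + x) (- z) (- y) ⟩
      (z + x) + (- z - y)      ≈⟨ +-congˡ (-‿+-comm z y) ⟩
      (z + x) - (z + y)        ∎

  ⟦⊖⟧ : ∀ m n → ⟦ m ℤ.⊖ n ⟧ ≈ m ×′ 1# - n ×′ 1#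
  ⟦⊖⟧ m zero = begin
    ⟦ m ℤ.⊖ 0 ⟧     ≡⟨ ≡.cong ⟦_⟧ (ℤₚ.≤-⊖ {n = m} z≤n) ⟩
    m ×′ 1#          ≈⟨ +-identityʳ (m ×′ 1#) ⟨
    m ×′ 1# + 0#     ≈⟨ +-congˡ -0#≈0# ⟨
    m ×′ 1# - 0 ×′ 1# ∎
  ⟦⊖⟧ zero (suc n) = sym (+-identityˡ _)
  ⟦⊖⟧ (suc m) (suc n) = begin
    ⟦ suc m ℤ.⊖ suc n ⟧ ≡⟨ ≡.cong ⟦_⟧ (ℤₚ.[1+m]⊖[1+n]≡m⊖n m n) ⟩
    ⟦ m ℤ.⊖ n ⟧         ≈⟨ ⟦⊖⟧ m n ⟩
    m ×′ 1# - n ×′ 1#     ≈⟨ x-y≈[z+x]-[z+y] (m ×′ 1#) (n ×′ 1#) 1# ⟩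
    (1# + m ×′ 1#) - (1# + n ×′ 1#) ≈⟨ +-cong (×-homo-+ 1# 1 m) (-‿cong (×-homo-+ 1# 1 n)) ⟨
    suc m ×′ 1# - suc n ×′ 1# ∎

  ⟦+⟧ : ∀ i j → ⟦ i ℤ.+ j ⟧ ≈ ⟦ i ⟧ + ⟦ j ⟧
  ⟦+⟧ (+ m) (+ n) = ×-homo-+ 1# m n
  ⟦+⟧ (+ m) -[1+ n ] = ⟦⊖⟧ m (suc n)
  ⟦+⟧ -[1+ m ] (+ n) = trans (⟦⊖⟧ n (suc m)) (+-comm _ _)
  ⟦+⟧ -[1+ m ] -[1+ n ] = begin
    - (suc (suc (m ℕ.+ n)) ×′ 1#)      ≡⟨ ≡.cong (λ k → - (suc k ×′ 1#)) (ℕₚ.+-suc m n) ⟨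
    - ((suc m ℕ.+ suc n) ×′ 1#)        ≈⟨ -‿cong (×-homo-+ 1# (suc m) (suc n)) ⟩
    - (suc m ×′ 1# + suc n ×′ 1#)       ≈⟨ -‿+-comm _ _ ⟨
    - (suc m ×′ 1#) - suc n ×′ 1#       ∎

  ⟦-⟧ : ∀ i → ⟦ ℤ.- i ⟧ ≈ - ⟦ i ⟧
  ⟦-⟧ (+ zero)   = sym -0#≈0#
  ⟦-⟧ (+ suc n)  = refl
  ⟦-⟧ -[1+ n ]   = sym (-‿involutive _)

  private
    ⟦+◃_⟧ : ∀ n → ⟦ Sign.+ ℤ.◃ n ⟧ ≈ n ×′ 1#
    ⟦+◃ zero ⟧  = refl
    ⟦+◃ suc n ⟧ = refl

    ⟦-◃_⟧ : ∀ n → ⟦ Sign.- ℤ.◃ n ⟧ ≈ - (n ×′ 1#)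
    ⟦-◃ zero ⟧  = sym -0#≈0#
    ⟦-◃ suc n ⟧ = refl

  ⟦*⟧ : ∀ i j → ⟦ i ℤ.* j ⟧ ≈ ⟦ i ⟧ * ⟦ j ⟧
  ⟦*⟧ (+ m) (+ n) = trans ⟦+◃ m ℕ.* n ⟧ (×1-homo-* m n)
  ⟦*⟧ (+ m) -[1+ n ] = begin
    ⟦ Sign.- ℤ.◃ (m ℕ.* suc n) ⟧ ≈⟨ ⟦-◃ m ℕ.* suc n ⟧ ⟩
    - ((m ℕ.* suc n) ×′ 1#)       ≈⟨ -‿cong (×1-homo-* m (suc n)) ⟩
    - (m ×′ 1# * suc n ×′ 1#)      ≈⟨ -‿distribʳ-* _ _ ⟩
    m ×′ 1# * - (suc n ×′ 1#)      ∎
  ⟦*⟧ -[1+ m ] (+ n) = begin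
    ⟦ Sign.- ℤ.◃ (suc m ℕ.* n) ⟧ ≈⟨ ⟦-◃ suc m ℕ.* n ⟧ ⟩
    - ((suc m ℕ.* n) ×′ 1#)       ≈⟨ -‿cong (×1-homo-* (suc m) n) ⟩
    - (suc m ×′ 1# * n ×′ 1#)      ≈⟨ -‿distribˡ-* _ _ ⟩
    - (suc m ×′ 1#) * n ×′ 1#      ∎
  ⟦*⟧ -[1+ m ] -[1+ n ] = begin
    ⟦ Sign.+ ℤ.◃ (suc m ℕ.* suc n) ⟧     ≈⟨ ⟦+◃ suc m ℕ.* suc n ⟧ ⟩
    (suc m ℕ.* suc n) ×′ 1#               ≈⟨ ×1-homo-* (suc m) (suc n) ⟩
    suc m ×′ 1# * suc n ×′ 1#              ≈⟨ -‿involutive _ ⟨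
    - - (suc m ×′ 1# * suc n ×′ 1#)        ≈⟨ -‿cong (-‿distribˡ-* _ _) ⟩
    - (- (suc m ×′ 1#) * suc n ×′ 1#)      ≈⟨ -‿distribʳ-* _ _ ⟩
    - (suc m ×′ 1#) * - (suc n ×′ 1#)      ∎

  ⟦⟧-homomorphism : ℤ.+-*-rawRing AlmostCommutativeRing.-Raw-AlmostCommutative⟶
                      AlmostCommutativeRing.fromCommutativeRing R
  ⟦⟧-homomorphism = record
    { ⟦_⟧ = ⟦_⟧ ; +-homo = ⟦+⟧ ; *-homo = ⟦*⟧ ; -‿homo = ⟦-⟧
    ; 0-homo = refl ; 1-homo = refl }

  ⟦⟧-equal? : ∀ i j → Maybe (⟦ i ⟧ ≈ ⟦ j ⟧)
  ⟦⟧-equal? i j with i ℤ.≟ j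
  ... | yes ≡.refl = just refl
  ... | no _       = nothing

  open import Algebra.Solver.Ring ℤ.+-*-rawRing (AlmostCommutativeRing.fromCommutativeRing R)
    ⟦⟧-homomorphism ⟦⟧-equal? public
    using (solve; _:=_; _:+_; _:*_; :-_; _:-_; con)

data Mod3 : ℕ → Set where
  3j   : ∀ j → Mod3 (j ℕ.* 3)
  3j+1 : ∀ j → Mod3 (j ℕ.* 3 ℕ.+ 1)
  3j+2 : ∀ j → Mod3 (j ℕ.* 3 ℕ.+ 2)

mod3 : ∀ n → Mod3 n
mod3 zero = 3j 0
mod3 (suc n) with mod3 n
... | 3j j   = ≡.subst Mod3 (ℕₚ.+-comm (j ℕ.* 3) 1) (3j+1 j)
... | 3j+1 j = ≡.subst Mod3 (ℕₚ.+-suc (j ℕ.* 3) 1) (3j+2 j)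
... | 3j+2 j = ≡.subst Mod3 (≡.trans (ℕₚ.+-comm 3 (j ℕ.* 3)) (ℕₚ.+-suc (j ℕ.* 3) 2)) (3j (suc j))

least-witness : ∀ {p} {P : Pred ℕ p} → Decidable P → ∀ {m} → P m → ∃ λ k → P k × (∀ j → j ℕ.< k → ¬ P j)
least-witness {P = P} P? {m} Pm with search (suc m)
  where
  search : ∀ n → (∀ j → j ℕ.< n → ¬ P j) ⊎ (∃ λ k → P k × (∀ j → j ℕ.< k → ¬ P j))
  search zero = inj₁ (λ _ ())
  search (suc n) with search n
  ... | inj₂ least = inj₂ least
  ... | inj₁ none-below-n with P? n
  ...   | yes Pn  = inj₂ (n , Pn , none-below-n)
  ...   | no  ¬Pn = inj₁ λ j j<1+n →
    Sum.[ none-below-n j , (λ { ≡.refl → ¬Pn }) ]′ (ℕₚ.m≤n⇒m<n∨m≡n (ℕₚ.≤-pred j<1+n))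
... | inj₂ least     = least
... | inj₁ none-below = ⊥-elim (none-below m (ℕₚ.n<1+n m) Pm)

length-filter-split : ∀ {a p} {A : Set a} {P : Pred A p} (P? : Decidable P) xs →
                      length (filter P? xs) ℕ.+ length (filter (¬? ∘ P?) xs) ≡ length xs
length-filter-split P? []       = ≡.refl
length-filter-split P? (x ∷ xs) with P? x
... | yes _ = ≡.cong suc (length-filter-split P? xs)
... | no  _ = ≡.trans (ℕₚ.+-suc _ _) (≡.cong suc (length-filter-split P? xs))

module _ where
  open ℕₚ.≤-Reasoning
  open import Data.Nat using (_+_; _*_; _∸_; _≤_)
  open import Data.Nat.Tactic.RingSolver using (solve-∀)

  2s≤q+1 : ∀ {s s₀ s′ q} → s₀ + s′ ≡ s → suc (s + s′) ≤ q → s₀ ≤ 2 → 2 * s ≤ q + 1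
  2s≤q+1 {s} {s₀} {s′} {q} s₀+s′≡s 1+s+s′≤q s₀≤2 = begin
    2 * s              ≡⟨ double s ⟩
    s + s              ≡⟨ ≡.cong (λ n → s + n) s₀+s′≡s ⟨
    s + (s₀ + s′)      ≤⟨ ℕₚ.+-monoʳ-≤ s (ℕₚ.+-monoˡ-≤ s′ s₀≤2) ⟩
    s + (2 + s′)       ≡⟨ shuffle s s′ ⟩
    suc (s + s′) + 1   ≤⟨ ℕₚ.+-monoˡ-≤ 1 1+s+s′≤q ⟩
    q + 1              ∎
    where
    double : ∀ s → 2 * s ≡ s + s
    double = solve-∀
    shuffle : ∀ s s′ → s + (2 + s′) ≡ suc (s + s′) + 1
    shuffle = solve-∀

  1+2s≤q : ∀ {s s′ q} → s′ ≡ s → suc (s + s′) ≤ q → suc (2 * s) ≤ q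
  1+2s≤q {s} ≡.refl = ≡.subst (λ n → suc (s + n) ≤ _) (≡.sym (ℕₚ.+-identityʳ s))

  q∸1≤2g : ∀ {s g q} → s + g ≡ q → 2 * s ≤ q + 1 → q ∸ 1 ≤ 2 * g
  q∸1≤2g {s} {g} {q} s+g≡q 2s≤q+1 = ℕₚ.m≤n+o⇒m∸n≤o q 1 (ℕₚ.+-cancelˡ-≤ q q (1 + 2 * g) (begin
    q + q                       ≡⟨ ≡.cong₂ _+_ s+g≡q s+g≡q ⟨
    (s + g) + (s + g)           ≡⟨ shuffle s g ⟩
    2 * s + 2 * g               ≤⟨ ℕₚ.+-monoˡ-≤ (2 * g) 2s≤q+1 ⟩
    (q + 1) + 2 * g             ≡⟨ ℕₚ.+-assoc q 1 (2 * g) ⟩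
    q + (1 + 2 * g)             ∎))
    where
    shuffle : ∀ s g → (s + g) + (s + g) ≡ 2 * s + 2 * g
    shuffle = solve-∀

  q+1≤2g : ∀ {s g q} → s + g ≡ q → suc (2 * s) ≤ q → q + 1 ≤ 2 * g
  q+1≤2g {s} {g} {q} s+g≡q 1+2s≤q = ℕₚ.+-cancelˡ-≤ q (q + 1) (2 * g) (begin
    q + (q + 1)                 ≡⟨ ≡.cong (λ n → n + (n + 1)) s+g≡q ⟨
    (s + g) + ((s + g) + 1)     ≡⟨ shuffle s g ⟩
    suc (2 * s) + 2 * g         ≤⟨ ℕₚ.+-monoˡ-≤ (2 * g) 1+2s≤q ⟩
    q + 2 * g                   ∎)
    where
    shuffle : ∀ s g → (s + g) + ((s + g) + 1) ≡ suc (2 * s) + 2 * g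
    shuffle = solve-∀

module PeriodicWord {a} {A : Set a} (u v : A) where
  open import Data.Nat using (_+_; _*_)

  data Phase : Set where
    p₀ p₁ p₂ : Phase

  next : Phase → Phase
  next p₀ = p₁
  next p₁ = p₂
  next p₂ = p₀

  advance : ℕ → Phase → Phase
  advance zero    s = s
  advance (suc n) s = advance n (next s)

  letter : Phase → A
  letter p₀ = u
  letter p₁ = v
  letter p₂ = v

  periodic : Phase → ℕ → List A
  periodic s zero    = []
  periodic s (suc n) = letter s ∷ periodic (next s) n

  advance-+ : ∀ m n s → advance (m + n) s ≡ advance n (advance m s)
  advance-+ zero    n s = ≡.refl
  advance-+ (suc m) n s = advance-+ m n (next s)

  advance-*3 : ∀ k s → advance (k * 3) s ≡ s
  advance-*3 zero    s  = ≡.refl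
  advance-*3 (suc k) p₀ = advance-*3 k p₀
  advance-*3 (suc k) p₁ = advance-*3 k p₁
  advance-*3 (suc k) p₂ = advance-*3 k p₂

  length-periodic : ∀ s n → length (periodic s n) ≡ n
  length-periodic s zero    = ≡.refl
  length-periodic s (suc n) = ≡.cong suc (length-periodic (next s) n)

  periodic-+ : ∀ s m n → periodic s (m + n) ≡ periodic s m ++ periodic (advance m s) n
  periodic-+ s zero    n = ≡.refl
  periodic-+ s (suc m) n = ≡.cong (letter s ∷_) (periodic-+ (next s) m n)

  periodic-*3+ : ∀ k n → periodic p₀ (k * 3 + n) ≡ periodic p₀ (k * 3) ++ periodic p₀ n
  periodic-*3+ k n = ≡.trans (periodic-+ p₀ (k * 3) n)
    (≡.cong (λ s → periodic p₀ (k * 3) ++ periodic s n) (advance-*3 k p₀))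

  periodic-*3+2 : ∀ k → periodic p₀ (k * 3 + 2) ≡ periodic p₀ (k * 3 + 1) ++ v ∷ []
  periodic-*3+2 k = begin
    periodic p₀ (k * 3 + 2)                     ≡⟨ periodic-*3+ k 2 ⟩
    periodic p₀ (k * 3) ++ u ∷ v ∷ []           ≡⟨ Listₚ.++-assoc (periodic p₀ (k * 3)) (u ∷ []) (v ∷ []) ⟨
    (periodic p₀ (k * 3) ++ u ∷ []) ++ v ∷ []   ≡⟨ ≡.cong (_++ v ∷ []) (periodic-*3+ k 1) ⟨
    periodic p₀ (k * 3 + 1) ++ v ∷ []           ∎
    where open ≡.≡-Reasoning

  take-periodic : ∀ s m n → take m (periodic s (m + n)) ≡ periodic s m
  take-periodic s zero    n = ≡.refl
  take-periodic s (suc m) n = ≡.cong (letter s ∷_) (take-periodic (next s) m n)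

  drop-periodic : ∀ s m n → drop m (periodic s (m + n)) ≡ periodic (advance m s) n
  drop-periodic s zero    n = ≡.refl
  drop-periodic s (suc m) n = drop-periodic (next s) m n

  trinomial≡periodic : ∀ k → concat (replicate k (u ∷ v ∷ v ∷ [])) ≡ periodic p₀ (k * 3)
  trinomial≡periodic zero    = ≡.refl
  trinomial≡periodic (suc k) = ≡.cong (λ w → u ∷ v ∷ v ∷ w) (trinomial≡periodic k)

  reverse-periodic : ∀ k → reverse (periodic p₀ (k * 3)) ≡ periodic p₁ (k * 3)
  reverse-periodic zero    = ≡.refl
  reverse-periodic (suc k) = begin
    reverse (u ∷ v ∷ v ∷ periodic p₀ (k * 3))         ≡⟨ Listₚ.reverse-++ (u ∷ v ∷ v ∷ []) (periodic p₀ (k * 3)) ⟩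
    reverse (periodic p₀ (k * 3)) ++ periodic p₁ 3    ≡⟨ ≡.cong (_++ periodic p₁ 3) (reverse-periodic k) ⟩
    periodic p₁ (k * 3) ++ periodic p₁ 3              ≡⟨ ≡.cong (λ s → periodic p₁ (k * 3) ++ periodic s 3) (advance-*3 k p₁) ⟨
    periodic p₁ (k * 3) ++ periodic (advance (k * 3) p₁) 3 ≡⟨ periodic-+ p₁ (k * 3) 3 ⟨
    periodic p₁ (k * 3 + 3)                           ≡⟨ ≡.cong (periodic p₁) (ℕₚ.+-comm (k * 3) 3) ⟩
    periodic p₁ (suc k * 3)                           ∎
    where open ≡.≡-Reasoning

  rotate-periodic : ∀ s k j → ∃ λ s′ → drop j (periodic s (k * 3)) ++ take j (periodic s (k * 3)) ≡ periodic s′ (k * 3)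
  rotate-periodic s k j with ℕₚ.≤-total j (k * 3)
  ... | inj₁ j≤n = advance j s , (begin
    drop j (periodic s n) ++ take j (periodic s n)
      ≡⟨ ≡.cong (λ m → drop j (periodic s m) ++ take j (periodic s m)) n≡j+r ⟩
    drop j (periodic s (j + r)) ++ take j (periodic s (j + r))
      ≡⟨ ≡.cong₂ _++_ (drop-periodic s j r) (take-periodic s j r) ⟩
    periodic (advance j s) r ++ periodic s j
      ≡⟨ ≡.cong (λ s′ → periodic (advance j s) r ++ periodic s′ j) full-turn ⟨
    periodic (advance j s) r ++ periodic (advance r (advance j s)) j
      ≡⟨ periodic-+ (advance j s) r j ⟨
    periodic (advance j s) (r + j)
      ≡⟨ ≡.cong (periodic (advance j s)) (ℕₚ.+-comm r j) ⟩
    periodic (advance j s) (j + r)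
      ≡⟨ ≡.cong (periodic (advance j s)) n≡j+r ⟨
    periodic (advance j s) n ∎)
    where
    open ≡.≡-Reasoning
    n r : ℕ
    n = k * 3
    r = n ℕ.∸ j
    n≡j+r : n ≡ j + r
    n≡j+r = ≡.sym (ℕₚ.m+[n∸m]≡n j≤n)
    full-turn : advance r (advance j s) ≡ s
    full-turn = ≡.trans (≡.sym (advance-+ j r s)) (≡.trans (≡.cong (λ m → advance m s) (≡.sym n≡j+r)) (advance-*3 k s))
  ... | inj₂ n≤j = s , ≡.cong₂ _++_ (Listₚ.drop-all j w (ℕₚ.≤-trans (ℕₚ.≤-reflexive (length-periodic s (k * 3))) n≤j))
                                  (Listₚ.take-all j w (ℕₚ.≤-trans (ℕₚ.≤-reflexive (length-periodic s (k * 3))) n≤j))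
    where
    w : List A
    w = periodic s (k * 3)

  inner-window : ∀ {r} {R : A → A → Set r} s n x as y bs →
                 Pointwise R (periodic s n) (x ∷ as ++ y ∷ bs) →
                 ∃ λ s′ → Pointwise R (periodic s′ (length bs)) bs × (2 + length as + length bs ≡ n)
  inner-window s zero             x as       y bs ()
  inner-window s (suc zero)       x []       y bs (_ ∷ ())
  inner-window {R = R} s (suc (suc n)) x [] y bs (_ ∷ _ ∷ p) =
    advance 2 s , ≡.subst (λ m → Pointwise R (periodic (advance 2 s) m) bs) n≡∣bs∣ p , ≡.cong (λ m → 2 + m) (≡.sym n≡∣bs∣)
    where
    n≡∣bs∣ : n ≡ length bs
    n≡∣bs∣ = ≡.trans (≡.sym (length-periodic _ n)) (Pointwise-length p)
  inner-window s (suc n)          x (a ∷ as) y bs (_ ∷ p) with inner-window (next s) n a as y bs p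
  ... | s′ , q , len = s′ , q , ≡.cong suc len

module RingBasics {c ℓ : Level} (K : CommutativeRing c ℓ) where
  open CommutativeRing K
  open IntegerCoefficients K using (solve; _:=_; _:+_; _:*_; :-_; _:-_; con)
  open import Algebra.Properties.Semiring.Exp semiring using (_^_)
  open import Algebra.Properties.Ring ring public
    using () renaming (x≈y⇒x∙y⁻¹≈ε to x≈y⇒x-y≈0; x∙y⁻¹≈ε⇒x≈y to x-y≈0⇒x≈y)
  open import Relation.Binary.Reasoning.Setoid setoid

  drop-vanishing : ∀ {x y e} z → e ≈ 0# → x ≈ y + z * e → x ≈ y
  drop-vanishing {x} {y} {e} z e≈0 x≈y+ze = begin
    x          ≈⟨ x≈y+ze ⟩
    y + z * e  ≈⟨ +-congˡ (trans (*-congˡ e≈0) (zeroʳ z)) ⟩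
    y + 0#     ≈⟨ +-identityʳ y ⟩
    y          ∎

  -- Spelled to coincide definitionally with the solver constants con (+ 2) and con (+ 4).
  2# 4# : Carrier
  2# = 1# + 1#
  4# = 2# + 1# + 1#

  x*y≈1⇒xⁿ*yⁿ≈1 : ∀ {x y} → x * y ≈ 1# → ∀ n → x ^ n * y ^ n ≈ 1#
  x*y≈1⇒xⁿ*yⁿ≈1 xy≈1 zero = *-identityˡ 1#
  x*y≈1⇒xⁿ*yⁿ≈1 {x} {y} xy≈1 (suc n) = begin
    (x * x ^ n) * (y * y ^ n) ≈⟨ solve 4 (λ x y X Y → (x :* X) :* (y :* Y) := (x :* y) :* (X :* Y)) refl x y (x ^ n) (y ^ n) ⟩
    (x * y) * (x ^ n * y ^ n) ≈⟨ *-cong xy≈1 (x*y≈1⇒xⁿ*yⁿ≈1 xy≈1 n) ⟩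
    1# * 1#                   ≈⟨ *-identityˡ 1# ⟩
    1#                        ∎

  Is±1 : Carrier → Set ℓ
  Is±1 x = x ≈ 1# ⊎ x ≈ - 1#

  Is±1-resp : ∀ {x y} → x ≈ y → Is±1 x → Is±1 y
  Is±1-resp x≈y (inj₁ x≈1)  = inj₁ (trans (sym x≈y) x≈1)
  Is±1-resp x≈y (inj₂ x≈-1) = inj₂ (trans (sym x≈y) x≈-1)

  Is±1-neg : ∀ {x} → Is±1 (- x) → Is±1 x
  Is±1-neg {x} (inj₁ -x≈1)  = inj₂ (trans (solve 1 (λ x → x := :- (:- x)) refl x) (-‿cong -x≈1))
  Is±1-neg {x} (inj₂ -x≈-1) = inj₁ (trans (solve 1 (λ x → x := :- (:- x)) refl x)
                                     (trans (-‿cong -x≈-1) (solve 0 (:- (:- con ℤ.1ℤ) := con ℤ.1ℤ) refl)))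

  Is±1⇒square≈1 : ∀ {ε} → Is±1 ε → ε * ε ≈ 1#
  Is±1⇒square≈1 (inj₁ ε≈1)  = trans (*-cong ε≈1 ε≈1) (*-identityˡ 1#)
  Is±1⇒square≈1 (inj₂ ε≈-1) = trans (*-cong ε≈-1 ε≈-1) (solve 0 (:- con ℤ.1ℤ :* :- con ℤ.1ℤ := con ℤ.1ℤ) refl)

  x*y≈1⇒y≈1⇒x≈1 : ∀ {x y} → x * y ≈ 1# → y ≈ 1# → x ≈ 1#
  x*y≈1⇒y≈1⇒x≈1 {x} {y} xy≈1 y≈1 = begin
    x      ≈⟨ *-identityʳ x ⟨
    x * 1# ≈⟨ *-congˡ y≈1 ⟨
    x * y  ≈⟨ xy≈1 ⟩
    1#     ∎

  x*y≈1⇒y≈-1⇒x≈-1 : ∀ {x y} → x * y ≈ 1# → y ≈ - 1# → x ≈ - 1#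
  x*y≈1⇒y≈-1⇒x≈-1 {x} {y} xy≈1 y≈-1 = begin
    x            ≈⟨ solve 1 (λ x → x := :- (x :* :- con ℤ.1ℤ)) refl x ⟩
    - (x * - 1#) ≈⟨ -‿cong (*-congˡ y≈-1) ⟨
    - (x * y)    ≈⟨ -‿cong xy≈1 ⟩
    - 1#         ∎

  inverse-Is±1 : ∀ {x y} → x * y ≈ 1# → Is±1 y → Is±1 x
  inverse-Is±1 xy≈1 = Sum.map (x*y≈1⇒y≈1⇒x≈1 xy≈1) (x*y≈1⇒y≈-1⇒x≈-1 xy≈1)

module Matrices {c ℓ : Level} (K : CommutativeRing c ℓ) where
  open CommutativeRing K
  open EA rawRing
  open Mat
  open IntegerCoefficients K using (solve; _:=_; _:+_; _:*_; :-_; _:-_; con)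
  open RingBasics K using (Is±1; Is±1-resp; Is±1-neg)
  open import Relation.Binary.Reasoning.Setoid setoid

  ≈M-isEquivalence : IsEquivalence _≈M_
  ≈M-isEquivalence = record
    { refl  = refl , refl , refl , refl
    ; sym   = λ (p , q , r , s) → sym p , sym q , sym r , sym s
    ; trans = λ (p , q , r , s) (p′ , q′ , r′ , s′) → trans p p′ , trans q q′ , trans r r′ , trans s s′
    }

  open IsEquivalence ≈M-isEquivalence public
    using ()
    renaming (refl to ≈M-refl; sym to ≈M-sym; trans to ≈M-trans)

  ·-cong : ∀ {A A′ B B′} → A ≈M A′ → B ≈M B′ → (A · B) ≈M (A′ · B′)
  ·-cong (p , q , r , s) (p′ , q′ , r′ , s′) =
    +-cong (*-cong p p′) (*-cong q r′) , +-cong (*-cong p q′) (*-cong q s′) ,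
    +-cong (*-cong r p′) (*-cong s r′) , +-cong (*-cong r q′) (*-cong s s′)

  ·-assoc : ∀ A B C → ((A · B) · C) ≈M (A · (B · C))
  ·-assoc (mat a b c′ d) (mat e f g h) (mat i j k l) =
    entry a b e f g h i k , entry a b e f g h j l , entry c′ d e f g h i k , entry c′ d e f g h j l
    where
    entry : ∀ a b e f g h i j → (a * e + b * g) * i + (a * f + b * h) * j ≈ a * (e * i + f * j) + b * (g * i + h * j)
    entry = solve 8 (λ a b e f g h i j → (a :* e :+ b :* g) :* i :+ (a :* f :+ b :* h) :* j
                                       := a :* (e :* i :+ f :* j) :+ b :* (g :* i :+ h :* j)) refl

  ·-identityˡ : ∀ A → (Id · A) ≈M A
  ·-identityˡ (mat a b c′ d) = entry a c′ , entry b d , entry′ a c′ , entry′ b d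
    where
    entry : ∀ x y → 1# * x + 0# * y ≈ x
    entry = solve 2 (λ x y → con ℤ.1ℤ :* x :+ con ℤ.0ℤ :* y := x) refl
    entry′ : ∀ x y → 0# * x + 1# * y ≈ y
    entry′ = solve 2 (λ x y → con ℤ.0ℤ :* x :+ con ℤ.1ℤ :* y := y) refl

  ·-identityʳ : ∀ A → (A · Id) ≈M A
  ·-identityʳ (mat a b c′ d) = entry a b , entry′ a b , entry c′ d , entry′ c′ d
    where
    entry : ∀ x y → x * 1# + y * 0# ≈ x
    entry = solve 2 (λ x y → x :* con ℤ.1ℤ :+ y :* con ℤ.0ℤ := x) refl
    entry′ : ∀ x y → x * 0# + y * 1# ≈ y
    entry′ = solve 2 (λ x y → x :* con ℤ.0ℤ :+ y :* con ℤ.1ℤ := y) refl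

  Mᵃ-· : ∀ x {A p q r s} → A ≈M mat p q r s → (Mᵃ x · A) ≈M mat (x * p - r) (x * q - s) p q
  Mᵃ-· x {A} {p} {q} {r} {s} A≈ = ≈M-trans (·-cong ≈M-refl A≈) (top p r , top q s , bottom p r , bottom q s)
    where
    top : ∀ p r → x * p + - 1# * r ≈ x * p - r
    top = solve 3 (λ x p r → x :* p :+ (:- con ℤ.1ℤ) :* r := x :* p :- r) refl x
    bottom : ∀ p r → 1# * p + 0# * r ≈ p
    bottom = solve 2 (λ p r → con ℤ.1ℤ :* p :+ con ℤ.0ℤ :* r := p) refl

  ·-Mᵃ : ∀ A x → (A · Mᵃ x) ≈M mat (m11 A * x + m12 A) (- m11 A) (m21 A * x + m22 A) (- m21 A)
  ·-Mᵃ A x = left (m11 A) (m12 A) , right (m11 A) (m12 A) , left (m21 A) (m22 A) , right (m21 A) (m22 A)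
    where
    left : ∀ p q → p * x + q * 1# ≈ p * x + q
    left = solve 3 (λ x p q → p :* x :+ q :* con ℤ.1ℤ := p :* x :+ q) refl x
    right : ∀ p q → p * - 1# + q * 0# ≈ - p
    right = solve 2 (λ p q → p :* (:- con ℤ.1ℤ) :+ q :* con ℤ.0ℤ := :- p) refl

  private
    step : Mat → Carrier → Mat
    step A x = Mᵃ x · A

    foldl-cong : ∀ {A B} xs → A ≈M B → foldl step A xs ≈M foldl step B xs
    foldl-cong []       A≈B = A≈B
    foldl-cong (x ∷ xs) A≈B = foldl-cong xs (·-cong ≈M-refl A≈B)

    foldl-· : ∀ A B xs → foldl step (A · B) xs ≈M (foldl step A xs · B)
    foldl-· A B []       = ≈M-refl
    foldl-· A B (x ∷ xs) = ≈M-trans (foldl-cong xs (≈M-sym (·-assoc _ A B))) (foldl-· _ B xs)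

  M-∷ : ∀ x xs → M (x ∷ xs) ≈M (M xs · Mᵃ x)
  M-∷ x xs = ≈M-trans (foldl-cong xs (≈M-trans (·-identityʳ _) (≈M-sym (·-identityˡ _)))) (foldl-· Id (Mᵃ x) xs)

  M-∷ʳ : ∀ xs x → M (xs ++ x ∷ []) ≡ (Mᵃ x · M xs)
  M-∷ʳ xs x = Listₚ.foldl-++ step Id xs (x ∷ [])

  M-++ : ∀ xs ys → M (xs ++ ys) ≈M (M ys · M xs)
  M-++ xs ys rewrite Listₚ.foldl-++ step Id xs ys =
    ≈M-trans (foldl-cong ys (≈M-sym (·-identityˡ (M xs)))) (foldl-· Id (M xs) ys)

  M-cong : ∀ {xs ys} → xs ≈L ys → M xs ≈M M ys
  M-cong []                        = ≈M-refl
  M-cong {x ∷ xs} {y ∷ ys} (x≈y ∷ xs≈ys) =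
    ≈M-trans (M-∷ x xs) (≈M-trans (·-cong (M-cong xs≈ys) (x≈y , refl , refl , refl)) (≈M-sym (M-∷ y ys)))

  m11-∷ : ∀ x xs → m11 (M (x ∷ xs)) ≈ m11 (M xs) * x + m12 (M xs)
  m11-∷ x xs = proj₁ (≈M-trans (M-∷ x xs) (·-Mᵃ (M xs) x))

  m12-∷ : ∀ x xs → m12 (M (x ∷ xs)) ≈ - m11 (M xs)
  m12-∷ x xs = proj₁ (proj₂ (≈M-trans (M-∷ x xs) (·-Mᵃ (M xs) x)))

  m11-∷-≈ : ∀ x xs {p q r s} → M xs ≈M mat p q r s → m11 (M (x ∷ xs)) ≈ p * x + q
  m11-∷-≈ x xs (p≈ , q≈ , _) = trans (m11-∷ x xs) (+-cong (*-congʳ p≈) q≈)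

  m11-∷∷-≈ : ∀ x y xs {p q r s} → M xs ≈M mat p q r s → m11 (M (x ∷ y ∷ xs)) ≈ (p * y + q) * x - p
  m11-∷∷-≈ x y xs M≈@(p≈ , _) = trans (m11-∷ x (y ∷ xs)) (+-cong (*-congʳ (m11-∷-≈ y xs M≈)) (trans (m12-∷ y xs) (-‿cong p≈)))

  module _ (_≟_ : Relation.Binary.Definitions.Decidable _≈_) where

    _≈M?_ : ∀ A B → Dec (A ≈M B)
    mat a b c′ d ≈M? mat e f g h = (a ≟ e) ×-dec (b ≟ f) ×-dec (c′ ≟ g) ×-dec (d ≟ h)

    IsSolution? : ∀ xs → Dec (IsSolution xs)
    IsSolution? xs = (M xs ≈M? Id) ⊎-dec (M xs ≈M? -Id)

  IsSolution⇒Is±1-inner : ∀ b bs b′ → IsSolution (b ∷ bs ++ b′ ∷ []) → Is±1 (m11 (M bs))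
  IsSolution⇒Is±1-inner b bs b′ sol = Is±1-neg (Is±1-resp m22≈-m11 (m22-±1 sol))
    where
    m22≈-m11 : m22 (M (b ∷ bs ++ b′ ∷ [])) ≈ - m11 (M bs)
    m22≈-m11 = begin
      m22 (M ((b ∷ bs) ++ b′ ∷ []))   ≡⟨ ≡.cong m22 (M-∷ʳ (b ∷ bs) b′) ⟩
      m22 (Mᵃ b′ · M (b ∷ bs))         ≈⟨ proj₂ (proj₂ (proj₂ (Mᵃ-· b′ {M (b ∷ bs)} ≈M-refl))) ⟩
      m12 (M (b ∷ bs))                 ≈⟨ m12-∷ b bs ⟩
      - m11 (M bs)                     ∎
    m22-±1 : IsSolution (b ∷ bs ++ b′ ∷ []) → Is±1 (m22 (M (b ∷ bs ++ b′ ∷ [])))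
    m22-±1 (inj₁ M≈Id)  = inj₁ (proj₂ (proj₂ (proj₂ M≈Id)))
    m22-±1 (inj₂ M≈-Id) = inj₂ (proj₂ (proj₂ (proj₂ M≈-Id)))

module Trinomials {c ℓ : Level} (K : CommutativeRing c ℓ) where
  open import Data.Integer using (+_)
  open CommutativeRing K
  open EA rawRing
  open Mat
  open IntegerCoefficients K using (solve; _:=_; _:+_; _:*_; :-_; _:-_; con)
  open RingBasics K
  open Matrices K
  open import Algebra.Properties.Semiring.Exp semiring using (_^_)
  open import Algebra.Properties.Ring ring using (-0#≈0#; -‿involutive)
  open import Relation.Binary.Reasoning.Setoid setoid

  module _ {u v : Carrier} (uv≈1 : u * v ≈ 1#) where
    open PeriodicWord u v

    a d : Carrier
    a = - u
    d = - v

    aʲdʲ≈1 : ∀ j → a ^ j * d ^ j ≈ 1#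
    aʲdʲ≈1 = x*y≈1⇒xⁿ*yⁿ≈1 (trans (solve 2 (λ u v → :- u :* :- v := u :* v) refl u v) uv≈1)

    private
      uv-1≈0 : u * v - 1# ≈ 0#
      uv-1≈0 = x≈y⇒x-y≈0 uv≈1

    M-uvv : M (u ∷ v ∷ v ∷ []) ≈M mat a (1# - d * d) 0# d
    M-uvv = ≈M-trans (Mᵃ-· v (Mᵃ-· v (Mᵃ-· u {Id} ≈M-refl))) (e11 , e12 , e21 , e22)
      where
      e11 : v * (v * (u * 1# - 0#) - 1#) - (u * 1# - 0#) ≈ a
      e11 = drop-vanishing v uv-1≈0 (solve 2 (λ u v →
              v :* (v :* (u :* con ℤ.1ℤ :- con ℤ.0ℤ) :- con ℤ.1ℤ) :- (u :* con ℤ.1ℤ :- con ℤ.0ℤ)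
              := :- u :+ v :* (u :* v :- con ℤ.1ℤ)) refl u v)
      e12 : v * (v * (u * 0# - 1#) - 0#) - (u * 0# - 1#) ≈ 1# - d * d
      e12 = solve 2 (λ u v → v :* (v :* (u :* con ℤ.0ℤ :- con ℤ.1ℤ) :- con ℤ.0ℤ) :- (u :* con ℤ.0ℤ :- con ℤ.1ℤ)
              := con ℤ.1ℤ :- (:- v) :* (:- v)) refl u v
      e21 : v * (u * 1# - 0#) - 1# ≈ 0#
      e21 = drop-vanishing 1# uv-1≈0 (solve 2 (λ u v → v :* (u :* con ℤ.1ℤ :- con ℤ.0ℤ) :- con ℤ.1ℤ
              := con ℤ.0ℤ :+ con ℤ.1ℤ :* (u :* v :- con ℤ.1ℤ)) refl u v)
      e22 : v * (u * 0# - 1#) - 0# ≈ d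
      e22 = solve 2 (λ u v → v :* (u :* con ℤ.0ℤ :- con ℤ.1ℤ) :- con ℤ.0ℤ := :- v) refl u v

    M-periodic-*3 : ∀ j → M (periodic p₀ (j ℕ.* 3)) ≈M mat (a ^ j) (d * (a ^ j - d ^ j)) 0# (d ^ j)
    M-periodic-*3 zero = refl , solve 1 (λ v → con ℤ.0ℤ := :- v :* (con ℤ.1ℤ :- con ℤ.1ℤ)) refl v , refl , refl
    M-periodic-*3 (suc j) =
      ≈M-trans (M-++ (u ∷ v ∷ v ∷ []) (periodic p₀ (j ℕ.* 3)))
        (≈M-trans (·-cong (M-periodic-*3 j) M-uvv) (e11 , e12 , e21 , e22))
      where
      A D : Carrier
      A = a ^ j
      D = d ^ j
      e11 : A * a + d * (A - D) * 0# ≈ a * A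
      e11 = solve 4 (λ A D u v → A :* (:- u) :+ ((:- v) :* (A :- D)) :* con ℤ.0ℤ := (:- u) :* A) refl A D u v
      e12 : A * (1# - d * d) + d * (A - D) * d ≈ d * (a * A - d * D)
      e12 = drop-vanishing (- A) uv-1≈0 (solve 4 (λ A D u v →
              A :* (con ℤ.1ℤ :- (:- v) :* (:- v)) :+ ((:- v) :* (A :- D)) :* (:- v)
              := (:- v) :* ((:- u) :* A :- (:- v) :* D) :+ (:- A) :* (u :* v :- con ℤ.1ℤ)) refl A D u v)
      e21 : 0# * a + D * 0# ≈ 0#
      e21 = solve 2 (λ D u → con ℤ.0ℤ :* (:- u) :+ D :* con ℤ.0ℤ := con ℤ.0ℤ) refl D u
      e22 : 0# * (1# - d * d) + D * d ≈ d * D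
      e22 = solve 2 (λ D v → con ℤ.0ℤ :* (con ℤ.1ℤ :- (:- v) :* (:- v)) :+ D :* (:- v) := (:- v) :* D) refl D v

    trinomial-solution : ∀ j → Is±1 (a ^ j) → IsSolution (trinomial u v j)
    trinomial-solution j a^j±1 rewrite trinomial≡periodic j =
      Sum.map (λ A≈1  → diagonal A≈1  (x*y≈1⇒y≈1⇒x≈1  dʲaʲ≈1 A≈1))
              (λ A≈-1 → diagonal A≈-1 (x*y≈1⇒y≈-1⇒x≈-1 dʲaʲ≈1 A≈-1)) a^j±1
      where
      dʲaʲ≈1 : d ^ j * a ^ j ≈ 1#
      dʲaʲ≈1 = trans (*-comm _ _) (aʲdʲ≈1 j)
      diagonal : ∀ {ε} → a ^ j ≈ ε → d ^ j ≈ ε → M (periodic p₀ (j ℕ.* 3)) ≈M mat ε 0# 0# ε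
      diagonal A≈ε D≈ε = ≈M-trans (M-periodic-*3 j)
        (A≈ε , trans (*-congˡ (x≈y⇒x-y≈0 (trans A≈ε (sym D≈ε)))) (zeroʳ d) , refl , D≈ε)

    M-periodic-*3+1 : ∀ j → M (periodic p₀ (j ℕ.* 3 ℕ.+ 1)) ≈M mat (- (a * a ^ j)) (- a ^ j) (a ^ j) (d * (a ^ j - d ^ j))
    M-periodic-*3+1 j rewrite periodic-*3+ j 1 | M-∷ʳ (periodic p₀ (j ℕ.* 3)) u =
      ≈M-trans (Mᵃ-· u (M-periodic-*3 j)) (e11 , e12 , refl , refl)
      where
      A D : Carrier
      A = a ^ j
      D = d ^ j
      e11 : u * A - 0# ≈ - (a * A)
      e11 = solve 2 (λ u A → u :* A :- con ℤ.0ℤ := :- (:- u :* A)) refl u A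
      e12 : u * (d * (A - D)) - D ≈ - A
      e12 = drop-vanishing (D - A) uv-1≈0 (solve 4 (λ u v A D →
              u :* (:- v :* (A :- D)) :- D := :- A :+ (D :- A) :* (u :* v :- con ℤ.1ℤ)) refl u v A D)

    M-periodic-*3+2 : ∀ j → M (periodic p₀ (j ℕ.* 3 ℕ.+ 2)) ≈M mat 0# (d * d ^ j) (- (a * a ^ j)) (- a ^ j)
    M-periodic-*3+2 j rewrite periodic-*3+2 j | M-∷ʳ (periodic p₀ (j ℕ.* 3 ℕ.+ 1)) v =
      ≈M-trans (Mᵃ-· v (M-periodic-*3+1 j)) (e11 , e12 , refl , refl)
      where
      A D : Carrier
      A = a ^ j
      D = d ^ j
      e11 : v * - (a * A) - A ≈ 0#
      e11 = drop-vanishing A uv-1≈0 (solve 3 (λ u v A →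
              v :* :- (:- u :* A) :- A := con ℤ.0ℤ :+ A :* (u :* v :- con ℤ.1ℤ)) refl u v A)
      e12 : v * - A - d * (A - D) ≈ d * D
      e12 = solve 3 (λ v A D → v :* :- A :- :- v :* (A :- D) := :- v :* D) refl v A D

    ∼-trinomial⇒periodic : ∀ k {ws} → trinomial u v k ∼ ws → ∃ λ s → periodic s (k ℕ.* 3) ≈L ws
    ∼-trinomial⇒periodic k (j , inj₁ rotation) rewrite trinomial≡periodic k with rotate-periodic p₀ k j
    ... | s , rotation≡ = s , ≡.subst (_≈L _) rotation≡ rotation
    ∼-trinomial⇒periodic k (j , inj₂ rotation) rewrite trinomial≡periodic k | reverse-periodic k
      with rotate-periodic p₁ k j
    ... | s , rotation≡ = s , ≡.subst (_≈L _) rotation≡ rotation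

    module _ {k : ℕ} (0≉1 : ¬ 0# ≈ 1#)
             (minimal : ∀ j → 1 ℕ.≤ j → j ℕ.< k → ¬ IsSolution (trinomial u v j))
             (u²+4-nonsquare : ∀ w → ¬ w * w ≈ u * u + 4#) where

      ¬Is±1-0# : ¬ Is±1 0#
      ¬Is±1-0# (inj₁ 0≈1)  = 0≉1 0≈1
      ¬Is±1-0# (inj₂ 0≈-1) = 0≉1 (begin
        0#       ≈⟨ -0#≈0# ⟨
        - 0#     ≈⟨ -‿cong 0≈-1 ⟩
        - - 1#   ≈⟨ -‿involutive 1# ⟩
        1#       ∎)

      ¬Is±1-a^ : ∀ m → 1 ℕ.≤ m → m ℕ.< k → ¬ Is±1 (a ^ m)
      ¬Is±1-a^ m 1≤m m<k = minimal m 1≤m m<k ∘ trinomial-solution m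

      ¬Is±1-d^ : ∀ m → 1 ℕ.≤ m → m ℕ.< k → ¬ Is±1 (d ^ m)
      ¬Is±1-d^ m 1≤m m<k = ¬Is±1-a^ m 1≤m m<k ∘ inverse-Is±1 (aʲdʲ≈1 m)

      -- For X = d^(j+2) - aʲ, the relations X² = 1, uv = 1 and aʲdʲ = 1 give (u aʲ + v dʲ)² = u² + 4.
      ¬Is±1-d²dʲ-aʲ : ∀ j → ¬ Is±1 (d * (d * d ^ j) - a ^ j)
      ¬Is±1-d²dʲ-aʲ j X±1 = u²+4-nonsquare (u * A + v * D)
        (drop-vanishing 4# (x≈y⇒x-y≈0 (aʲdʲ≈1 j))
        (drop-vanishing (2# * A * D * (u * v + 2#) - v * v * D * D * (u * v + 1#)) uv-1≈0
        (drop-vanishing (u * u) (x≈y⇒x-y≈0 (Is±1⇒square≈1 X±1))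
          (solve 4 (λ u v A D →
             (u :* A :+ v :* D) :* (u :* A :+ v :* D)
             := u :* u :+ con (+ 4)
                :+ con (+ 4) :* (A :* D :- con ℤ.1ℤ)
                :+ (con (+ 2) :* A :* D :* (u :* v :+ con (+ 2)) :- v :* v :* D :* D :* (u :* v :+ con ℤ.1ℤ))
                   :* (u :* v :- con ℤ.1ℤ)
                :+ u :* u :* ((:- v :* (:- v :* D) :- A) :* (:- v :* (:- v :* D) :- A) :- con ℤ.1ℤ)) refl u v A D))))
        where
        A D : Carrier
        A = a ^ j
        D = d ^ j

      private
        below-k : ∀ {m r} → m ℕ.* 3 ℕ.≤ 2 ℕ.+ r → 3 ℕ.+ r ℕ.≤ k ℕ.* 3 → m ℕ.< k
        below-k {m} m*3≤2+r 3+r≤k*3 = ℕₚ.*-cancelʳ-< 3 m k (ℕₚ.<-≤-trans (s≤s m*3≤2+r) 3+r≤k*3)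

      window₀-¬Is±1 : ∀ r → 1 ℕ.≤ r → 3 ℕ.+ r ℕ.≤ k ℕ.* 3 → ¬ Is±1 (m11 (M (periodic p₀ r)))
      window₀-¬Is±1 r 1≤r 3+r≤k*3 ±1 with mod3 r
      window₀-¬Is±1 _ () _ _ | 3j zero
      ... | 3j (suc j) = ¬Is±1-a^ (suc j) (s≤s z≤n) (below-k (ℕₚ.m≤n+m _ 2) 3+r≤k*3)
                           (Is±1-resp (proj₁ (M-periodic-*3 (suc j))) ±1)
      ... | 3j+1 j = ¬Is±1-a^ (suc j) (s≤s z≤n)
                       (below-k (ℕₚ.≤-reflexive (≡.cong (2 ℕ.+_) (ℕₚ.+-comm 1 (j ℕ.* 3)))) 3+r≤k*3)
                       (Is±1-neg (Is±1-resp (proj₁ (M-periodic-*3+1 j)) ±1))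
      ... | 3j+2 j = ¬Is±1-0# (Is±1-resp (proj₁ (M-periodic-*3+2 j)) ±1)

      window₂-¬Is±1 : ∀ n → 3 ℕ.+ suc n ℕ.≤ k ℕ.* 3 → ¬ Is±1 (m11 (M (v ∷ periodic p₀ n)))
      window₂-¬Is±1 n 3+r≤k*3 ±1 with mod3 n
      ... | 3j j = ¬Is±1-d^ (suc j) (s≤s z≤n) (below-k ℕₚ.≤-refl 3+r≤k*3)
                     (Is±1-neg (Is±1-resp (trans (m11-∷-≈ v (periodic p₀ (j ℕ.* 3)) (M-periodic-*3 j)) e) ±1))
        where
        e : a ^ j * v + d * (a ^ j - d ^ j) ≈ - (d * d ^ j)
        e = solve 3 (λ v A D → A :* v :+ :- v :* (A :- D) := :- (:- v :* D)) refl v (a ^ j) (d ^ j)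
      ... | 3j+1 j = ¬Is±1-0# (Is±1-resp (trans (m11-∷-≈ v (periodic p₀ (j ℕ.* 3 ℕ.+ 1)) (M-periodic-*3+1 j)) e) ±1)
        where
        e : - (a * a ^ j) * v + - a ^ j ≈ 0#
        e = drop-vanishing (a ^ j) uv-1≈0 (solve 3 (λ u v A →
              :- (:- u :* A) :* v :+ :- A := con ℤ.0ℤ :+ A :* (u :* v :- con ℤ.1ℤ)) refl u v (a ^ j))
      ... | 3j+2 j = ¬Is±1-d^ (suc j) (s≤s z≤n) (below-k (ℕₚ.+-monoʳ-≤ 3 (ℕₚ.m≤m+n (j ℕ.* 3) 2)) 3+r≤k*3)
                       (Is±1-resp (trans (m11-∷-≈ v (periodic p₀ (j ℕ.* 3 ℕ.+ 2)) (M-periodic-*3+2 j)) e) ±1)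
        where
        e : 0# * v + d * d ^ j ≈ d * d ^ j
        e = solve 2 (λ v D → con ℤ.0ℤ :* v :+ :- v :* D := :- v :* D) refl v (d ^ j)

      window₁-¬Is±1 : ∀ n → 3 ℕ.+ suc (suc n) ℕ.≤ k ℕ.* 3 → ¬ Is±1 (m11 (M (v ∷ v ∷ periodic p₀ n)))
      window₁-¬Is±1 n 3+r≤k*3 ±1 with mod3 n
      ... | 3j j = ¬Is±1-d²dʲ-aʲ j (Is±1-resp (trans (m11-∷∷-≈ v v (periodic p₀ (j ℕ.* 3)) (M-periodic-*3 j)) e) ±1)
        where
        e : (a ^ j * v + d * (a ^ j - d ^ j)) * v - a ^ j ≈ d * (d * d ^ j) - a ^ j
        e = solve 3 (λ v A D → (A :* v :+ :- v :* (A :- D)) :* v :- A := :- v :* (:- v :* D) :- A) refl v (a ^ j) (d ^ j)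
      ... | 3j+1 j = ¬Is±1-a^ (suc j) (s≤s z≤n)
                       (below-k (ℕₚ.m≤n⇒m≤1+n (ℕₚ.+-monoʳ-≤ 3 (ℕₚ.m≤m+n (j ℕ.* 3) 1))) 3+r≤k*3)
                       (Is±1-resp (trans (m11-∷∷-≈ v v (periodic p₀ (j ℕ.* 3 ℕ.+ 1)) (M-periodic-*3+1 j)) e) ±1)
        where
        e : (- (a * a ^ j) * v + - a ^ j) * v - - (a * a ^ j) ≈ a * a ^ j
        e = drop-vanishing (a ^ j * v) uv-1≈0 (solve 3 (λ u v A →
              (:- (:- u :* A) :* v :+ :- A) :* v :- :- (:- u :* A)
              := :- u :* A :+ A :* v :* (u :* v :- con ℤ.1ℤ)) refl u v (a ^ j))
      ... | 3j+2 j = ¬Is±1-d^ (suc (suc j)) (s≤s z≤n)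
                       (below-k (ℕₚ.≤-reflexive (≡.cong (4 ℕ.+_) (ℕₚ.+-comm 2 (j ℕ.* 3)))) 3+r≤k*3)
                       (Is±1-neg (Is±1-resp (trans (m11-∷∷-≈ v v (periodic p₀ (j ℕ.* 3 ℕ.+ 2)) (M-periodic-*3+2 j)) e) ±1))
        where
        e : (0# * v + d * d ^ j) * v - 0# ≈ - (d * (d * d ^ j))
        e = solve 2 (λ v D → (con ℤ.0ℤ :* v :+ :- v :* D) :* v :- con ℤ.0ℤ := :- (:- v :* (:- v :* D))) refl v (d ^ j)

      window-¬Is±1 : ∀ s r → 1 ℕ.≤ r → 3 ℕ.+ r ℕ.≤ k ℕ.* 3 → ¬ Is±1 (m11 (M (periodic s r)))
      window-¬Is±1 p₀ r             1≤r = window₀-¬Is±1 r 1≤r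
      window-¬Is±1 p₁ (suc zero)    _   3+r≤k*3 ±1 =
        ¬Is±1-d^ 1 (s≤s z≤n) (below-k ℕₚ.≤-refl 3+r≤k*3) (Is±1-neg (Is±1-resp e ±1))
        where
        e : v * 1# + - 1# * 0# ≈ - (d * 1#)
        e = solve 1 (λ v → v :* con ℤ.1ℤ :+ :- con ℤ.1ℤ :* con ℤ.0ℤ := :- (:- v :* con ℤ.1ℤ)) refl v
      window-¬Is±1 p₁ (suc (suc n)) _   = window₁-¬Is±1 n
      window-¬Is±1 p₂ (suc n)       _   = window₂-¬Is±1 n

      trinomial-irreducible : 1 ℕ.≤ k → Irreducible (trinomial u v k)
      trinomial-irreducible 1≤k = 3≤length , ¬reducible
        where
        3≤length : 3 ℕ.≤ length (trinomial u v k)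
        3≤length rewrite trinomial≡periodic k | length-periodic p₀ (k ℕ.* 3) = ℕₚ.*-monoˡ-≤ 3 1≤k
        ¬reducible : ¬ Reducible (trinomial u v k)
        ¬reducible (_ , as , _ , b₁ , bs , bₘ , 1≤|as| , 1≤|bs| , solution , trinomial∼⊕)
          with ∼-trinomial⇒periodic k trinomial∼⊕
        ... | s , periodic≈⊕ with inner-window s (k ℕ.* 3) _ as _ bs periodic≈⊕
        ... | s′ , periodic≈bs , |⊕|≡k*3 =
          window-¬Is±1 s′ (length bs) 1≤|bs|
            (≡.subst (3 ℕ.+ length bs ℕ.≤_) |⊕|≡k*3 (ℕₚ.+-monoˡ-≤ (length bs) (s≤s (s≤s 1≤|as|))))
            (Is±1-resp (sym (proj₁ (M-cong periodic≈bs))) (IsSolution⇒Is±1-inner b₁ bs bₘ solution))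

    minimal-trinomial : Relation.Binary.Definitions.Decidable _≈_ →
                        ∀ {m} → 1 ℕ.≤ m → a ^ m ≈ 1# → ∃ λ k → IsMinimalTrinomial u v k
    minimal-trinomial _≟_ {m} 1≤m aᵐ≈1
      with least-witness (λ n → (1 ℕ.≤? n) ×-dec IsSolution? _≟_ (trinomial u v n))
                         (1≤m , trinomial-solution m (inj₁ aᵐ≈1))
    ... | k , (1≤k , solution) , none-below = k , 1≤k , solution , λ j 1≤j j<k → none-below j j<k ∘ (1≤j ,_)

    minimal-trinomial-irreducible : Relation.Binary.Definitions.Decidable _≈_ → ¬ 0# ≈ 1# →
                                    ∀ {m} → 1 ℕ.≤ m → a ^ m ≈ 1# → (∀ w → ¬ w * w ≈ u * u + 4#) →
                                    ∃ λ k → IsMinimalTrinomial u v k × Irreducible (trinomial u v k)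
    minimal-trinomial-irreducible _≟_ 0≉1 1≤m aᵐ≈1 nonsquare with minimal-trinomial _≟_ 1≤m aᵐ≈1
    ... | k , minimal@(1≤k , _ , none-below) = k , minimal , trinomial-irreducible 0≉1 none-below nonsquare 1≤k

module FiniteField {c ℓ : Level} (K : CommutativeRing c ℓ) (q : ℕ) (F : IsFiniteField K q) where
  open import Data.Integer using (+_)
  open CommutativeRing K
  open IsFiniteField F
  open IntegerCoefficients K using (solve; _:=_; _:+_; _:*_; :-_; _:-_; con)
  open RingBasics K
  open import Algebra.Properties.Semiring.Exp semiring using (_^_; ^-homo-*)
  open import Algebra.Properties.Ring ring using (-0#≈0#; -‿involutive; +-cancelˡ)
  open import Relation.Binary.Reasoning.Setoid setoid

  index : Carrier → Fin q
  index x = proj₁ (enum-surjective x)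

  enum-index : ∀ x → enum (index x) ≈ x
  enum-index x = proj₂ (enum-surjective x)

  index-cong : ∀ {x y} → x ≈ y → index x ≡ index y
  index-cong {x} {y} x≈y = enum-injective (index x) (index y) (trans (enum-index x) (trans x≈y (sym (enum-index y))))

  index-injective : ∀ {x y} → index x ≡ index y → x ≈ y
  index-injective {x} {y} eq = trans (sym (enum-index x)) (trans (reflexive (≡.cong enum eq)) (enum-index y))

  x*y≈0⇒x≈0∨y≈0 : ∀ {x y} → x * y ≈ 0# → x ≈ 0# ⊎ y ≈ 0#
  x*y≈0⇒x≈0∨y≈0 {x} {y} xy≈0 with x ≟ 0#
  ... | yes x≈0 = inj₁ x≈0
  ... | no  x≉0 with inverse x x≉0
  ...   | z , xz≈1 = inj₂ (begin
    y           ≈⟨ *-identityˡ y ⟨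
    1# * y      ≈⟨ *-congʳ xz≈1 ⟨
    (x * z) * y ≈⟨ solve 3 (λ x y z → (x :* z) :* y := z :* (x :* y)) refl x y z ⟩
    z * (x * y) ≈⟨ *-congˡ xy≈0 ⟩
    z * 0#      ≈⟨ zeroʳ z ⟩
    0#          ∎)

  x≉0∧y≉0⇒x*y≉0 : ∀ {x y} → ¬ x ≈ 0# → ¬ y ≈ 0# → ¬ x * y ≈ 0#
  x≉0∧y≉0⇒x*y≉0 x≉0 y≉0 xy≈0 = Sum.[ x≉0 , y≉0 ]′ (x*y≈0⇒x≈0∨y≈0 xy≈0)

  *-cancelˡ : ∀ {z x y} → ¬ z ≈ 0# → z * x ≈ z * y → x ≈ y
  *-cancelˡ {z} {x} {y} z≉0 zx≈zy = x-y≈0⇒x≈y x y (Sum.[ ⊥-elim ∘ z≉0 , id ]′ (x*y≈0⇒x≈0∨y≈0 z[x-y]≈0))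
    where
    z[x-y]≈0 : z * (x - y) ≈ 0#
    z[x-y]≈0 = trans (solve 3 (λ z x y → z :* (x :- y) := z :* x :- z :* y) refl z x y) (x≈y⇒x-y≈0 zx≈zy)

  Distinct : List Carrier → Set (c ⊔ ℓ)
  Distinct = AllPairs (λ x y → ¬ x ≈ y)

  private
    lookup-injective : ∀ {xs} → Distinct xs → ∀ i j → lookup xs i ≈ lookup xs j → i ≡ j
    lookup-injective (_ ∷ _)      Fin.zero    Fin.zero    _ = ≡.refl
    lookup-injective (x≉xs ∷ _)   Fin.zero    (Fin.suc j) x≈ = ⊥-elim (All.lookup x≉xs (∈ₚ.∈-lookup j) x≈)
    lookup-injective (x≉xs ∷ _)   (Fin.suc i) Fin.zero    ≈x = ⊥-elim (All.lookup x≉xs (∈ₚ.∈-lookup i) (sym ≈x))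
    lookup-injective (_ ∷ xs!)    (Fin.suc i) (Fin.suc j) eq = ≡.cong Fin.suc (lookup-injective xs! i j eq)

    any-lookup : ∀ {x xs} → Any (x ≈_) xs → ∃ λ i → x ≈ lookup xs i
    any-lookup (here x≈)  = Fin.zero , x≈
    any-lookup (there x∈) with any-lookup x∈
    ... | i , x≈ = Fin.suc i , x≈

  Distinct⇒length≤q : ∀ {xs} → Distinct xs → length xs ℕ.≤ q
  Distinct⇒length≤q {xs} xs! = Finₚ.injective⇒≤ {f = index ∘ lookup xs}
    (λ {i} {j} eq → lookup-injective xs! i j (index-injective eq))

  covering⇒q≤length : ∀ {xs} → (∀ x → Any (x ≈_) xs) → q ℕ.≤ length xs
  covering⇒q≤length {xs} cover = Finₚ.injective⇒≤ {f = position} position-injective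
    where
    position : Fin q → Fin (length xs)
    position i = proj₁ (any-lookup (cover (enum i)))
    position-injective : ∀ {i j} → position i ≡ position j → i ≡ j
    position-injective {i} {j} eq = enum-injective i j (begin
      enum i                   ≈⟨ proj₂ (any-lookup (cover (enum i))) ⟩
      lookup xs (position i)   ≡⟨ ≡.cong (lookup xs) eq ⟩
      lookup xs (position j)   ≈⟨ proj₂ (any-lookup (cover (enum j))) ⟨
      enum j                   ∎)

  Distinct-map : ∀ {p} {P : Pred Carrier p} (f : Carrier → Carrier) →
                 (∀ {x y} → P x → P y → f x ≈ f y → x ≈ y) →
                 ∀ {xs} → All P xs → Distinct xs → Distinct (map f xs)
  Distinct-map f inj []         []           = []
  Distinct-map f inj (px ∷ pxs) (x≉xs ∷ xs!) =
    Allₚ.map⁺ (All.zipWith (λ (py , x≉y) → x≉y ∘ inj px py) (pxs , x≉xs)) ∷ Distinct-map f inj pxs xs!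

  at-most-two-square-roots : ∀ {a zs} → Distinct zs → All (λ z → z * z ≈ a) zs → length zs ℕ.≤ 2
  at-most-two-square-roots []                   _                     = z≤n
  at-most-two-square-roots (_ ∷ [])             _                     = s≤s z≤n
  at-most-two-square-roots (_ ∷ _ ∷ [])         _                     = s≤s (s≤s z≤n)
  at-most-two-square-roots {zs = x ∷ y ∷ z ∷ _} ((x≉y ∷ x≉z ∷ _) ∷ (y≉z ∷ _) ∷ _) (x² ∷ y² ∷ z² ∷ _) =
    ⊥-elim (y≉z (+-cancelˡ x y z (trans (opposite x² y² x≉y) (sym (opposite x² z² x≉z)))))
    where
    opposite : ∀ {x y a} → x * x ≈ a → y * y ≈ a → ¬ x ≈ y → x + y ≈ 0#
    opposite {x} {y} x²≈a y²≈a x≉y = Sum.[ ⊥-elim ∘ x≉y ∘ x-y≈0⇒x≈y x y , id ]′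
      (x*y≈0⇒x≈0∨y≈0 (trans (solve 2 (λ x y → (x :- y) :* (x :+ y) := x :* x :- y :* y) refl x y)
                                   (x≈y⇒x-y≈0 (trans x²≈a (sym y²≈a)))))

  elements : List Carrier
  elements = tabulate enum

  elements-distinct : Distinct elements
  elements-distinct = AllPairsₚ.tabulate⁺ (λ i≢j ei≈ej → i≢j (enum-injective _ _ ei≈ej))

  index∈elements : ∀ x → enum (index x) ∈ elements
  index∈elements x = ∈ₚ.∈-tabulate⁺ (index x)

  IsSquare : Carrier → Set (c ⊔ ℓ)
  IsSquare x = ∃ λ w → w * w ≈ x

  IsSquare? : Decidable IsSquare
  IsSquare? x = Dec.map′ (λ (i , i²≈x) → enum i , i²≈x)
                         (λ (w , w²≈x) → index w , trans (*-cong (enum-index w) (enum-index w)) w²≈x)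
                         (Finₚ.any? (λ i → (enum i * enum i) ≟ x))

  -- A square root of enum i when there is one, 0# otherwise; defining √ through the index
  -- makes it respect ≈.
  private
    √ᵢ : Fin q → Carrier
    √ᵢ i with IsSquare? (enum i)
    ... | yes (w , _) = w
    ... | no _        = 0#

  √ : Carrier → Carrier
  √ x = √ᵢ (index x)

  √-cong : ∀ {x y} → x ≈ y → √ x ≡ √ y
  √-cong x≈y = ≡.cong √ᵢ (index-cong x≈y)

  √-square : ∀ {x} → IsSquare x → √ x * √ x ≈ x
  √-square {x} (w , w²≈x) with IsSquare? (enum (index x))
  ... | yes (_ , v²≈x) = trans v²≈x (enum-index x)
  ... | no ¬square     = ⊥-elim (¬square (w , trans w²≈x (sym (enum-index x))))

  unit-finite-order : ∀ {x y} → x * y ≈ 1# → ∃ λ m → 1 ℕ.≤ m × x ^ m ≈ 1#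
  unit-finite-order {x} {y} xy≈1 with Finₚ.pigeonhole (ℕₚ.n<1+n q) (λ (i : Fin (suc q)) → index (x ^ toℕ i))
  ... | i , j , i<j , same-index = toℕ j ℕ.∸ toℕ i , ℕₚ.m<n⇒0<n∸m i<j , (begin
    x ^ m                      ≈⟨ *-identityˡ (x ^ m) ⟨
    1# * x ^ m                 ≈⟨ *-congʳ yⁱxⁱ≈1 ⟨
    (y ^ toℕ i * x ^ toℕ i) * x ^ m ≈⟨ *-assoc _ _ _ ⟩
    y ^ toℕ i * (x ^ toℕ i * x ^ m) ≈⟨ *-congˡ (^-homo-* x (toℕ i) m) ⟨
    y ^ toℕ i * x ^ (toℕ i ℕ.+ m)   ≡⟨ ≡.cong (λ e → y ^ toℕ i * x ^ e) (ℕₚ.m+[n∸m]≡n (ℕₚ.<⇒≤ i<j)) ⟩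
    y ^ toℕ i * x ^ toℕ j           ≈⟨ *-congˡ (index-injective same-index) ⟨
    y ^ toℕ i * x ^ toℕ i           ≈⟨ yⁱxⁱ≈1 ⟩
    1#                              ∎)
    where
    m : ℕ
    m = toℕ j ℕ.∸ toℕ i
    yⁱxⁱ≈1 : y ^ toℕ i * x ^ toℕ i ≈ 1#
    yⁱxⁱ≈1 = x*y≈1⇒xⁿ*yⁿ≈1 (trans (*-comm y x) xy≈1) (toℕ i)

  -- An element of multiplicative order 1 + n acts freely on the nonzero elements, so its orbits,
  -- each represented by its element of least index, partition them into blocks of size 1 + n.
  module _ {g : Carrier} (n : ℕ) (g¹⁺ⁿ≈1 : g ^ suc n ≈ 1#) (gᵐ≉1 : ∀ m → 1 ℕ.≤ m → m ℕ.≤ n → ¬ g ^ m ≈ 1#) where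

    private
      N : ℕ
      N = suc n

      unit≉0 : ∀ {x y} → x * y ≈ 1# → ¬ x ≈ 0#
      unit≉0 {x} {y} xy≈1 x≈0 = 0≉1 (trans (sym (trans (*-congʳ x≈0) (zeroˡ y))) xy≈1)

      gᵉ≉0 : ∀ e → ¬ g ^ e ≈ 0#
      gᵉ≉0 e = unit≉0 (x*y≈1⇒xⁿ*yⁿ≈1 g¹⁺ⁿ≈1 e)

      g^[t*N]≈1 : ∀ t → g ^ (t ℕ.* N) ≈ 1#
      g^[t*N]≈1 zero    = refl
      g^[t*N]≈1 (suc t) = trans (^-homo-* g N (t ℕ.* N)) (trans (*-cong g¹⁺ⁿ≈1 (g^[t*N]≈1 t)) (*-identityˡ 1#))

      g^-mod : ∀ e → g ^ e ≈ g ^ (e ℕ.% N)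
      g^-mod e = begin
        g ^ e                                    ≡⟨ ≡.cong (g ^_) (m≡m%n+[m/n]*n e N) ⟩
        g ^ (e ℕ.% N ℕ.+ e ℕ./ N ℕ.* N)          ≈⟨ ^-homo-* g (e ℕ.% N) (e ℕ./ N ℕ.* N) ⟩
        g ^ (e ℕ.% N) * g ^ (e ℕ./ N ℕ.* N)      ≈⟨ *-congˡ (g^[t*N]≈1 (e ℕ./ N)) ⟩
        g ^ (e ℕ.% N) * 1#                       ≈⟨ *-identityʳ _ ⟩
        g ^ (e ℕ.% N)                            ∎

      gⁱ≉gʲ : ∀ {i j} → i ℕ.< j → j ℕ.≤ n → ¬ g ^ i ≈ g ^ j
      gⁱ≉gʲ {i} {j} i<j j≤n gⁱ≈gʲ = gᵐ≉1 (j ℕ.∸ i) (ℕₚ.m<n⇒0<n∸m i<j)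
        (ℕₚ.≤-trans (ℕₚ.m∸n≤m j i) j≤n) (*-cancelˡ (gᵉ≉0 i) (begin
          g ^ i * g ^ (j ℕ.∸ i) ≈⟨ ^-homo-* g i (j ℕ.∸ i) ⟨
          g ^ (i ℕ.+ (j ℕ.∸ i)) ≡⟨ ≡.cong (g ^_) (ℕₚ.m+[n∸m]≡n (ℕₚ.<⇒≤ i<j)) ⟩
          g ^ j                 ≈⟨ gⁱ≈gʲ ⟨
          g ^ i                 ≈⟨ *-identityʳ (g ^ i) ⟨
          g ^ i * 1#            ∎))

      gᵃ*[gᵇ*x] : ∀ a b x → g ^ a * (g ^ b * x) ≈ g ^ (a ℕ.+ b) * x
      gᵃ*[gᵇ*x] a b x = trans (sym (*-assoc _ _ _)) (*-congʳ (sym (^-homo-* g a b)))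

      gⁱx≈y⇒x≈gⁱⁿy : ∀ i {x y} → g ^ i * x ≈ y → x ≈ g ^ (i ℕ.* n) * y
      gⁱx≈y⇒x≈gⁱⁿy i {x} {y} gⁱx≈y = begin
        x                                  ≈⟨ *-identityˡ x ⟨
        1# * x                             ≈⟨ *-congʳ (g^[t*N]≈1 i) ⟨
        g ^ (i ℕ.* N) * x                  ≡⟨ ≡.cong (λ e → g ^ e * x) (≡.trans (ℕₚ.*-suc i n) (ℕₚ.+-comm i (i ℕ.* n))) ⟩
        g ^ (i ℕ.* n ℕ.+ i) * x            ≈⟨ gᵃ*[gᵇ*x] (i ℕ.* n) i x ⟨
        g ^ (i ℕ.* n) * (g ^ i * x)        ≈⟨ *-congˡ gⁱx≈y ⟩
        g ^ (i ℕ.* n) * y                  ∎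

      gⁱx≈gʲy⇒x≈g^[in+j]y : ∀ i j {x y} → g ^ i * x ≈ g ^ j * y → x ≈ g ^ (i ℕ.* n ℕ.+ j) * y
      gⁱx≈gʲy⇒x≈g^[in+j]y i j {y = y} gⁱx≈gʲy = trans (gⁱx≈y⇒x≈gⁱⁿy i gⁱx≈gʲy) (gᵃ*[gᵇ*x] (i ℕ.* n) j y)

    Canonical : Carrier → Set ℓ
    Canonical x = ¬ x ≈ 0# × (∀ (e : Fin N) → toℕ (index x) ℕ.≤ toℕ (index (g ^ toℕ e * x)))

    Canonical? : Decidable Canonical
    Canonical? x = ¬? (x ≟ 0#) ×-dec Finₚ.all? (λ e → toℕ (index x) ℕ.≤? toℕ (index (g ^ toℕ e * x)))

    Canonical-resp : ∀ {x y} → x ≈ y → Canonical x → Canonical y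
    Canonical-resp {x} {y} x≈y (x≉0 , least) = x≉0 ∘ trans x≈y , λ e →
      ≡.subst₂ (λ i j → toℕ i ℕ.≤ toℕ j) (index-cong x≈y) (index-cong (*-congˡ x≈y)) (least e)

    canonical-least : ∀ {x} → Canonical x → ∀ e → toℕ (index x) ℕ.≤ toℕ (index (g ^ e * x))
    canonical-least {x} (_ , least) e = ≡.subst (λ i → toℕ (index x) ℕ.≤ toℕ i) (index-cong (*-congʳ gᵉ≈)) (least e′)
      where
      e′ : Fin N
      e′ = Fin.fromℕ< (m%n<n e N)
      gᵉ≈ : g ^ toℕ e′ ≈ g ^ e
      gᵉ≈ = trans (reflexive (≡.cong (g ^_) (Finₚ.toℕ-fromℕ< (m%n<n e N)))) (sym (g^-mod e))

    canonical-unique : ∀ {x y} i j → Canonical x → Canonical y → g ^ i * x ≈ g ^ j * y → x ≈ y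
    canonical-unique {x} {y} i j can-x can-y gⁱx≈gʲy = index-injective (Finₚ.toℕ-injective (ℕₚ.≤-antisym
      (≡.subst (λ k → toℕ (index x) ℕ.≤ toℕ k) (≡.sym (index-cong (gⁱx≈gʲy⇒x≈g^[in+j]y j i (sym gⁱx≈gʲy))))
               (canonical-least can-x (j ℕ.* n ℕ.+ i)))
      (≡.subst (λ k → toℕ (index y) ℕ.≤ toℕ k) (≡.sym (index-cong (gⁱx≈gʲy⇒x≈g^[in+j]y i j gⁱx≈gʲy)))
               (canonical-least can-y (i ℕ.* n ℕ.+ j)))))

    representatives : List Carrier
    representatives = filter Canonical? elements

    private
      representatives-canonical : All Canonical representatives
      representatives-canonical = Allₚ.all-filter Canonical? elements

      canonical∈representatives : ∀ {c} → c ∈ representatives → Canonical c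
      canonical∈representatives = proj₂ ∘ ∈ₚ.∈-filter⁻ Canonical? {xs = elements}

    orbits : ℕ → List Carrier
    orbits zero    = []
    orbits (suc e) = orbits e ++ map (g ^ e *_) representatives

    length-orbits : ∀ e → length (orbits e) ≡ e ℕ.* length representatives
    length-orbits zero    = ≡.refl
    length-orbits (suc e) = ≡.trans (Listₚ.length-++ (orbits e))
      (≡.trans (≡.cong₂ ℕ._+_ (length-orbits e) (Listₚ.length-map (g ^ e *_) representatives))
               (ℕₚ.+-comm (e ℕ.* length representatives) (length representatives)))

    ∈-orbits⁻ : ∀ e {y} → y ∈ orbits e → ∃₂ λ i c → i ℕ.< e × c ∈ representatives × y ≡ g ^ i * c
    ∈-orbits⁻ (suc e) y∈ with ∈ₚ.∈-++⁻ (orbits e) y∈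
    ... | inj₁ y∈orbits with ∈-orbits⁻ e y∈orbits
    ...   | i , c , i<e , c∈ , y≡ = i , c , ℕₚ.m<n⇒m<1+n i<e , c∈ , y≡
    ∈-orbits⁻ (suc e) y∈ | inj₂ y∈map with ∈ₚ.∈-map⁻ (g ^ e *_) y∈map
    ...   | c , c∈ , y≡ = e , c , ℕₚ.n<1+n e , c∈ , y≡

    ∈-orbits⁺ : ∀ e {i c} → i ℕ.< e → c ∈ representatives → g ^ i * c ∈ orbits e
    ∈-orbits⁺ (suc e) {i} i<1+e c∈ with ℕₚ.m≤n⇒m<n∨m≡n (ℕₚ.≤-pred i<1+e)
    ... | inj₁ i<e     = ∈ₚ.∈-++⁺ˡ (∈-orbits⁺ e i<e c∈)
    ... | inj₂ ≡.refl  = ∈ₚ.∈-++⁺ʳ (orbits e) (∈ₚ.∈-map⁺ (g ^ i *_) c∈)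

    orbits-nonzero : ∀ e → All (λ y → ¬ 0# ≈ y) (orbits e)
    orbits-nonzero e = All.tabulate case
      where
      case : ∀ {y} → y ∈ orbits e → ¬ 0# ≈ y
      case y∈ 0≈y with ∈-orbits⁻ e y∈
      ... | i , c , _ , c∈ , ≡.refl = x≉0∧y≉0⇒x*y≉0 (gᵉ≉0 i) (proj₁ (canonical∈representatives c∈)) (sym 0≈y)

    orbits-distinct : ∀ e → e ℕ.≤ N → Distinct (orbits e)
    orbits-distinct zero    _     = []
    orbits-distinct (suc e) 1+e≤N = AllPairsₚ.++⁺ (orbits-distinct e (ℕₚ.m≤n⇒m≤1+n (ℕₚ.≤-pred 1+e≤N)))
      (Distinct-map (g ^ e *_) (λ _ _ → *-cancelˡ (gᵉ≉0 e)) representatives-canonical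
        (AllPairsₚ.filter⁺ Canonical? elements-distinct))
      (All.tabulate λ y∈ → All.tabulate λ z∈ → separate y∈ z∈)
      where
      separate : ∀ {y z} → y ∈ orbits e → z ∈ map (g ^ e *_) representatives → ¬ y ≈ z
      separate y∈ z∈ y≈z with ∈-orbits⁻ e y∈ | ∈ₚ.∈-map⁻ (g ^ e *_) z∈
      ... | i , c , i<e , c∈ , ≡.refl | c′ , c′∈ , ≡.refl =
        gⁱ≉gʲ i<e (ℕₚ.≤-pred 1+e≤N) (*-cancelˡ c≉0 (begin
          c * g ^ i   ≈⟨ *-comm c (g ^ i) ⟩
          g ^ i * c   ≈⟨ y≈z ⟩
          g ^ e * c′  ≈⟨ *-congˡ (canonical-unique i e can-c (canonical∈representatives c′∈) y≈z) ⟨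
          g ^ e * c   ≈⟨ *-comm (g ^ e) c ⟩
          c * g ^ e   ∎))
        where
        can-c : Canonical c
        can-c = canonical∈representatives c∈
        c≉0 : ¬ c ≈ 0#
        c≉0 = proj₁ can-c

    private
      -- Descent on the index: if x is not canonical, some gᵉ x has smaller index.
      decompose : ∀ fuel x → toℕ (index x) ℕ.< fuel → ¬ x ≈ 0# →
                  ∃₂ λ e c → e ℕ.< N × c ∈ representatives × x ≈ g ^ e * c
      decompose (suc fuel) x index<fuel x≉0 with Canonical? x
      ... | yes can-x = 0 , enum (index x) , s≤s z≤n ,
                        ∈ₚ.∈-filter⁺ Canonical? (index∈elements x) (Canonical-resp (sym (enum-index x)) can-x) ,
                        trans (sym (enum-index x)) (sym (*-identityˡ _))
      ... | no ¬can-x with Finₚ.¬∀⟶∃¬ N _ (λ e → toℕ (index x) ℕ.≤? toℕ (index (g ^ toℕ e * x))) (¬can-x ∘ (x≉0 ,_))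
      ...   | e , ¬least with decompose fuel (g ^ toℕ e * x) (ℕₚ.<-≤-trans (ℕₚ.≰⇒> ¬least) (ℕₚ.≤-pred index<fuel))
                                  (x≉0∧y≉0⇒x*y≉0 (gᵉ≉0 (toℕ e)) x≉0)
      ...     | e′ , c , _ , c∈ , gᵉx≈gᵉ′c = (toℕ e ℕ.* n ℕ.+ e′) ℕ.% N , c , m%n<n (toℕ e ℕ.* n ℕ.+ e′) N , c∈ , (begin
        x                                     ≈⟨ gⁱx≈y⇒x≈gⁱⁿy (toℕ e) gᵉx≈gᵉ′c ⟩
        g ^ (toℕ e ℕ.* n) * (g ^ e′ * c)      ≈⟨ gᵃ*[gᵇ*x] (toℕ e ℕ.* n) e′ c ⟩
        g ^ (toℕ e ℕ.* n ℕ.+ e′) * c          ≈⟨ *-congʳ (g^-mod (toℕ e ℕ.* n ℕ.+ e′)) ⟩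
        g ^ ((toℕ e ℕ.* n ℕ.+ e′) ℕ.% N) * c  ∎)

    q≡1+[1+n]*orbits : q ≡ suc (suc n ℕ.* length representatives)
    q≡1+[1+n]*orbits = ℕₚ.≤-antisym
      (≡.subst (q ℕ.≤_) length≡ (covering⇒q≤length covering))
      (≡.subst (ℕ._≤ q) length≡ (Distinct⇒length≤q (orbits-nonzero N ∷ orbits-distinct N ℕₚ.≤-refl)))
      where
      length≡ : length (0# ∷ orbits N) ≡ suc (N ℕ.* length representatives)
      length≡ = ≡.cong suc (length-orbits N)
      covering : ∀ x → Any (x ≈_) (0# ∷ orbits N)
      covering x with x ≟ 0#
      ... | yes x≈0 = here x≈0
      ... | no  x≉0 with decompose (suc (toℕ (index x))) x ℕₚ.≤-refl x≉0
      ...   | e , c , e<N , c∈ , x≈gᵉc = there (Any.map (λ { ≡.refl → x≈gᵉc }) (∈-orbits⁺ N e<N c∈))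

  disc : Carrier → Carrier
  disc u = u * u + 4#

  square-discs : List Carrier
  square-discs = filter (IsSquare? ∘ disc) elements

  module _ (char≠2 : CharNot2 K) where

    -1≉1 : ¬ - 1# ≈ 1#
    -1≉1 -1≈1 = char≠2 (trans (+-congʳ (sym -1≈1)) (-‿inverseˡ 1#))

    q≡3[mod4]⇒-1-nonsquare : q ℕ.% 4 ≡ 3 → ∀ i → ¬ i * i ≈ - 1#
    q≡3[mod4]⇒-1-nonsquare q%4≡3 i i²≈-1 = 1≢3 (≡.trans (≡.sym q%4≡1) q%4≡3)
      where
      1≢3 : ¬ 1 ≡ 3
      1≢3 ()
      i²+1≈0 : i * i + 1# ≈ 0#
      i²+1≈0 = trans (+-congʳ i²≈-1) (-‿inverseˡ 1#)
      i≉±1 : ∀ {ε} → ε * ε ≈ 1# → ¬ i ≈ ε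
      i≉±1 {ε} ε²≈1 i≈ε = -1≉1 (trans (sym i²≈-1) (trans (*-cong i≈ε i≈ε) ε²≈1))
      i⁴≈1 : i ^ 4 ≈ 1#
      i⁴≈1 = drop-vanishing (i * i - 1#) i²+1≈0 (solve 1 (λ i →
               i :* (i :* (i :* (i :* con ℤ.1ℤ))) := con ℤ.1ℤ :+ (i :* i :- con ℤ.1ℤ) :* (i :* i :+ con ℤ.1ℤ)) refl i)
      iᵐ≉1 : ∀ m → 1 ℕ.≤ m → m ℕ.≤ 3 → ¬ i ^ m ≈ 1#
      iᵐ≉1 1 _ _ i¹≈1 = i≉±1 (*-identityˡ 1#) (trans (sym (*-identityʳ i)) i¹≈1)
      iᵐ≉1 2 _ _ i²≈1 = -1≉1 (trans (sym i²≈-1) (trans (*-congˡ (sym (*-identityʳ i))) i²≈1))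
      iᵐ≉1 3 _ _ i³≈1 = i≉±1 {ε = - 1#} (solve 0 (:- con ℤ.1ℤ :* :- con ℤ.1ℤ := con ℤ.1ℤ) refl) (begin
        i                          ≈⟨ drop-vanishing i i²+1≈0 (solve 1 (λ i →
                                        i := :- (i :* (i :* (i :* con ℤ.1ℤ))) :+ i :* (i :* i :+ con ℤ.1ℤ)) refl i) ⟩
        - (i * (i * (i * 1#)))     ≈⟨ -‿cong i³≈1 ⟩
        - 1#                       ∎)
      iᵐ≉1 (suc (suc (suc (suc _)))) _ (s≤s (s≤s (s≤s ())))
      r : ℕ
      r = length (representatives 3 i⁴≈1 iᵐ≉1)
      q%4≡1 : q ℕ.% 4 ≡ 1
      q%4≡1 = ≡.trans (≡.cong (ℕ._% 4) (≡.trans (q≡1+[1+n]*orbits 3 i⁴≈1 iᵐ≉1) (≡.cong suc (ℕₚ.*-comm 4 r))))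
                      ([m+kn]%n≡m%n 1 r 4)

    2≉0 : ¬ 2# ≈ 0#
    2≉0 = char≠2

    4≉0 : ¬ 4# ≈ 0#
    4≉0 4≈0 = x≉0∧y≉0⇒x*y≉0 2≉0 2≉0 (trans (solve 0 (con (+ 2) :* con (+ 2) := con (+ 4)) refl) 4≈0)

    private
      t⁺ t⁻ : Carrier → Carrier
      t⁺ x = x + √ (disc x)
      t⁻ x = x - √ (disc x)

      t⁺*t⁻ : ∀ {x} → IsSquare (disc x) → t⁺ x * t⁻ x ≈ - 4#
      t⁺*t⁻ {x} square = drop-vanishing (- 1#) (x≈y⇒x-y≈0 (√-square square)) (solve 2 (λ x w →
        (x :+ w) :* (x :- w) := :- con (+ 4) :+ (:- con ℤ.1ℤ) :* (w :* w :- (x :* x :+ con (+ 4)))) refl x (√ (disc x)))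

      t⁻*t⁺ : ∀ {x} → IsSquare (disc x) → t⁻ x * t⁺ x ≈ - 4#
      t⁻*t⁺ square = trans (*-comm _ _) (t⁺*t⁻ square)

      t⁺+t⁻ : ∀ x → t⁺ x + t⁻ x ≈ 2# * x
      t⁺+t⁻ x = solve 2 (λ x w → (x :+ w) :+ (x :- w) := con (+ 2) :* x) refl x (√ (disc x))

      t⁻+t⁺ : ∀ x → t⁻ x + t⁺ x ≈ 2# * x
      t⁻+t⁺ x = trans (+-comm _ _) (t⁺+t⁻ x)

      ≉0-of-*≈-4 : ∀ {a a′} → a * a′ ≈ - 4# → ¬ a ≈ 0#
      ≉0-of-*≈-4 {a} {a′} aa′≈-4 a≈0 = 4≉0 (begin
        4#        ≈⟨ -‿involutive 4# ⟨
        - - 4#    ≈⟨ -‿cong aa′≈-4 ⟨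
        - (a * a′) ≈⟨ -‿cong (trans (*-congʳ a≈0) (zeroˡ a′)) ⟩
        - 0#      ≈⟨ -0#≈0# ⟩
        0#        ∎)

      -- a determines a′ = -4/a, and then x = (a + a′)/2.
      recover : ∀ {x y a a′ b b′} → a * a′ ≈ - 4# → b * b′ ≈ - 4# →
                a + a′ ≈ 2# * x → b + b′ ≈ 2# * y → a ≈ b → x ≈ y
      recover {x} {y} {a} {a′} {b} {b′} aa′≈-4 bb′≈-4 a+a′≈2x b+b′≈2y a≈b = *-cancelˡ 2≉0 (begin
        2# * x   ≈⟨ a+a′≈2x ⟨
        a + a′   ≈⟨ +-cong a≈b a′≈b′ ⟩
        b + b′   ≈⟨ b+b′≈2y ⟩
        2# * y   ∎)
        where
        a′≈b′ : a′ ≈ b′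
        a′≈b′ = *-cancelˡ (≉0-of-*≈-4 aa′≈-4) (trans aa′≈-4 (trans (sym bb′≈-4) (*-congʳ (sym a≈b))))

      t⁺-injective : ∀ {x y} → IsSquare (disc x) → IsSquare (disc y) → t⁺ x ≈ t⁺ y → x ≈ y
      t⁺-injective {x} {y} sx sy = recover (t⁺*t⁻ sx) (t⁺*t⁻ sy) (t⁺+t⁻ x) (t⁺+t⁻ y)

      t⁻-injective : ∀ {x y} → IsSquare (disc x) → IsSquare (disc y) → t⁻ x ≈ t⁻ y → x ≈ y
      t⁻-injective {x} {y} sx sy = recover (t⁻*t⁺ sx) (t⁻*t⁺ sy) (t⁻+t⁺ x) (t⁻+t⁺ y)

      t⁺≉t⁻ : ∀ {x y} → IsSquare (disc x) → IsSquare (disc y) → ¬ √ (disc y) ≈ 0# → ¬ t⁺ x ≈ t⁻ y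
      t⁺≉t⁻ {x} {y} sx sy w≉0 t⁺x≈t⁻y = w≉0 (Sum.[ ⊥-elim ∘ 2≉0 , id ]′ (x*y≈0⇒x≈0∨y≈0 (begin
        2# * w             ≈⟨ solve 2 (λ y w → con (+ 2) :* w := (y :+ w) :- (y :- w)) refl y w ⟩
        (y + w) - (y - w)  ≈⟨ x≈y⇒x-y≈0 t⁺y≈t⁻y ⟩
        0#                 ∎)))
        where
        w : Carrier
        w = √ (disc y)
        x≈y : x ≈ y
        x≈y = recover (t⁺*t⁻ sx) (t⁻*t⁺ sy) (t⁺+t⁻ x) (t⁻+t⁺ y) t⁺x≈t⁻y
        t⁺y≈t⁻y : y + w ≈ y - w
        t⁺y≈t⁻y = trans (+-cong (sym x≈y) (reflexive (√-cong (+-congʳ (*-cong (sym x≈y) (sym x≈y)))))) t⁺x≈t⁻y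

      square-discs⁺ square-discs₀ : List Carrier
      square-discs⁺ = filter (λ x → ¬? (√ (disc x) ≟ 0#)) square-discs
      square-discs₀ = filter (λ x → √ (disc x) ≟ 0#) square-discs

      square-discs-square : All (IsSquare ∘ disc) square-discs
      square-discs-square = Allₚ.all-filter (IsSquare? ∘ disc) elements

      square-discs-distinct : Distinct square-discs
      square-discs-distinct = AllPairsₚ.filter⁺ (IsSquare? ∘ disc) elements-distinct

      square-discs⁺-square : All (IsSquare ∘ disc) square-discs⁺
      square-discs⁺-square = Allₚ.filter⁺ _ square-discs-square

    -- x + √(x² + 4) over all of square-discs and x - √(x² + 4) over square-discs⁺ are distinct and nonzero.
    1+|square-discs|+|square-discs⁺|≤q : suc (length square-discs ℕ.+ length square-discs⁺) ℕ.≤ q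
    1+|square-discs|+|square-discs⁺|≤q = ≡.subst (ℕ._≤ q) length≡ (Distinct⇒length≤q (nonzero ∷ distinct))
      where
      values : List Carrier
      values = map t⁺ square-discs ++ map t⁻ square-discs⁺
      length≡ : length (0# ∷ values) ≡ suc (length square-discs ℕ.+ length square-discs⁺)
      length≡ = ≡.cong suc (≡.trans (Listₚ.length-++ (map t⁺ square-discs))
                  (≡.cong₂ ℕ._+_ (Listₚ.length-map t⁺ square-discs) (Listₚ.length-map t⁻ square-discs⁺)))
      nonzero : All (λ b → ¬ 0# ≈ b) values
      nonzero = Allₚ.++⁺
        (Allₚ.map⁺ (All.map (λ sx 0≈ → ≉0-of-*≈-4 (t⁺*t⁻ sx) (sym 0≈)) square-discs-square))
        (Allₚ.map⁺ (All.map (λ sx 0≈ → ≉0-of-*≈-4 (t⁻*t⁺ sx) (sym 0≈)) square-discs⁺-square))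
      distinct : Distinct values
      distinct = AllPairsₚ.++⁺
        (Distinct-map t⁺ t⁺-injective square-discs-square square-discs-distinct)
        (Distinct-map t⁻ t⁻-injective square-discs⁺-square (AllPairsₚ.filter⁺ _ square-discs-distinct))
        (Allₚ.map⁺ (All.map (λ sx → Allₚ.map⁺ (All.map (λ (sy , w≉0) → t⁺≉t⁻ sx sy w≉0)
          (All.zip (square-discs⁺-square , Allₚ.all-filter _ square-discs)))) square-discs-square))

    private
      square-discs₀-roots : All (λ x → x * x ≈ - 4#) square-discs₀
      square-discs₀-roots = All.zipWith (λ (w≈0 , sx) → x²≈-4 w≈0 sx)
                   (Allₚ.all-filter _ square-discs , Allₚ.filter⁺ _ square-discs-square)
        where
        x²≈-4 : ∀ {x} → √ (disc x) ≈ 0# → IsSquare (disc x) → x * x ≈ - 4#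
        x²≈-4 {x} w≈0 sx = drop-vanishing 1# disc≈0 (solve 1 (λ x →
                             x :* x := :- con (+ 4) :+ con ℤ.1ℤ :* (x :* x :+ con (+ 4))) refl x)
          where
          disc≈0 : disc x ≈ 0#
          disc≈0 = trans (sym (√-square sx)) (trans (*-cong w≈0 w≈0) (zeroˡ 0#))

      length-square-discs : length square-discs₀ ℕ.+ length square-discs⁺ ≡ length square-discs
      length-square-discs = length-filter-split (λ x → √ (disc x) ≟ 0#) square-discs

      square-discs₀-distinct : Distinct square-discs₀
      square-discs₀-distinct = AllPairsₚ.filter⁺ _ square-discs-distinct

    2*|square-discs|≤q+1 : 2 ℕ.* length square-discs ℕ.≤ q ℕ.+ 1
    2*|square-discs|≤q+1 = 2s≤q+1 length-square-discs 1+|square-discs|+|square-discs⁺|≤q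
      (at-most-two-square-roots square-discs₀-distinct square-discs₀-roots)

    1+2*|square-discs|≤q : (∀ i → ¬ i * i ≈ - 1#) → suc (2 ℕ.* length square-discs) ℕ.≤ q
    1+2*|square-discs|≤q -1-nonsquare =
      1+2s≤q (≡.trans (≡.cong (ℕ._+ length square-discs⁺) (≡.sym |square-discs₀|≡0)) length-square-discs)
             1+|square-discs|+|square-discs⁺|≤q
      where
      h : Carrier
      h = proj₁ (inverse 2# 2≉0)
      2h≈1 : 2# * h ≈ 1#
      2h≈1 = proj₂ (inverse 2# 2≉0)
      -4-nonsquare : ∀ x → ¬ x * x ≈ - 4#
      -4-nonsquare x x²≈-4 = -1-nonsquare (x * h)
        (drop-vanishing (- (2# * h + 1#)) (x≈y⇒x-y≈0 2h≈1)
        (drop-vanishing (h * h) x²+4≈0 (solve 2 (λ x h →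
          (x :* h) :* (x :* h) := :- con ℤ.1ℤ :+ (:- (con (+ 2) :* h :+ con ℤ.1ℤ)) :* (con (+ 2) :* h :- con ℤ.1ℤ)
                                   :+ (h :* h) :* (x :* x :+ con (+ 4))) refl x h)))
        where
        x²+4≈0 : x * x + 4# ≈ 0#
        x²+4≈0 = trans (+-congʳ x²≈-4) (-‿inverseˡ 4#)
      |square-discs₀|≡0 : length square-discs₀ ≡ 0
      |square-discs₀|≡0 = none square-discs₀-roots
        where
        none : ∀ {xs} → All (λ x → x * x ≈ - 4#) xs → length xs ≡ 0
        none []            = ≡.refl
        none (x²≈-4 ∷ _)   = ⊥-elim (-4-nonsquare _ x²≈-4)

module GoodUnits {c ℓ : Level} (K : CommutativeRing c ℓ) (q : ℕ) (F : IsFiniteField K q) (char≠2 : CharNot2 K) where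
  open import Data.Integer using (+_)
  open CommutativeRing K
  open IsFiniteField F using (_≟_; 0≉1; enum)
  open EA rawRing using (MinTrinomialIrreducible; AtLeastHalfGood)
  open IntegerCoefficients K using (solve; _:=_; _:+_; _:*_; :-_; _:-_; con)
  open RingBasics K using (2#; drop-vanishing)
  open FiniteField K q F
  open Trinomials K using (minimal-trinomial-irreducible)

  good-units : List Carrier
  good-units = filter (¬? ∘ IsSquare? ∘ disc) elements

  nonsquare-disc⇒≉0 : ∀ {u} → ¬ IsSquare (disc u) → ¬ u ≈ 0#
  nonsquare-disc⇒≉0 {u} nonsquare u≈0 = nonsquare (2# , drop-vanishing (- u) u≈0 (solve 1 (λ u →
    con (+ 2) :* con (+ 2) := u :* u :+ con (+ 4) :+ :- u :* u) refl u))

  nonsquare-disc⇒irreducible : ∀ {u} → ¬ IsSquare (disc u) → MinTrinomialIrreducible u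
  nonsquare-disc⇒irreducible {u} nonsquare v uv≈1
    with unit-finite-order (trans (solve 2 (λ u v → :- u :* :- v := u :* v) refl u v) uv≈1)
  ... | m , 1≤m , aᵐ≈1 = minimal-trinomial-irreducible uv≈1 _≟_ 0≉1 1≤m aᵐ≈1 (λ w w²≈disc → nonsquare (w , w²≈disc))

  good-units-good : All (λ u → ¬ u ≈ 0# × MinTrinomialIrreducible u) good-units
  good-units-good = All.map (λ nonsquare → nonsquare-disc⇒≉0 nonsquare , nonsquare-disc⇒irreducible nonsquare)
                            (Allₚ.all-filter (¬? ∘ IsSquare? ∘ disc) elements)

  good-units-distinct : Distinct good-units
  good-units-distinct = AllPairsₚ.filter⁺ _ elements-distinct

  |square-discs|+|good-units|≡q : length square-discs ℕ.+ length good-units ≡ q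
  |square-discs|+|good-units|≡q = ≡.trans (length-filter-split (IsSquare? ∘ disc) elements) (Listₚ.length-tabulate enum)

  at-least-half-good : AtLeastHalfGood (q ℕ.∸ 1)
  at-least-half-good =
    good-units ,
    q∸1≤2g {length square-discs} {length good-units} |square-discs|+|good-units|≡q (2*|square-discs|≤q+1 char≠2) ,
    good-units-good , good-units-distinct

  at-least-half-good′ : (∀ i → ¬ i * i ≈ - 1#) → AtLeastHalfGood (q ℕ.+ 1)
  at-least-half-good′ -1-nonsquare =
    good-units ,
    q+1≤2g {length square-discs} {length good-units} |square-discs|+|good-units|≡q
      (1+2*|square-discs|≤q char≠2 -1-nonsquare) ,
    good-units-good , good-units-distinct

module IntegersModulo (p : ℕ) where
  open import Data.Integer using (+_)
  open import Data.Integer.Base using (_+_; _*_; -_; _-_)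
  open import Data.Integer.Divisibility.Signed using (divides; ∣ᵤ⇒∣; ∣⇒∣ᵤ; ∣m∣n⇒∣m+n; ∣m⇒∣-m; ∣n⇒∣m*n; ∣m⇒∣m*n)
    renaming (_∣_ to _∣ₛ_)
  open import Data.Integer.Tactic.RingSolver using (solve-∀)
  import Data.Integer.DivMod as ℤ
  open import Data.Nat.Divisibility as ℕ∣ using () renaming (_∣_ to _∣ℕ_)
  open import Data.Nat.Primality as Primality using (Prime)
  open import Data.Nat.Coprimality using (coprime-Bézout; prime⇒coprime)
  open import Data.Nat.GCD using (module Bézout)
  open RawRing (ℤmod p) using (_≈_)

  private
    ∣ₛ⇒≈ : ∀ {x y d} → + p ∣ₛ d → d ≡ x - y → x ≈ y
    ∣ₛ⇒≈ p∣d d≡x-y = ∣⇒∣ᵤ (≡.subst (+ p ∣ₛ_) d≡x-y p∣d)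

    ≈⇒∣ₛ : ∀ {x y} → x ≈ y → + p ∣ₛ (x - y)
    ≈⇒∣ₛ = ∣ᵤ⇒∣

  ≈-reflexive : ∀ {x y} → x ≡ y → x ≈ y
  ≈-reflexive {x} ≡.refl = ∣ₛ⇒≈ {x} {x} (divides ℤ.0ℤ ≡.refl) (≡.sym (ℤₚ.+-inverseʳ x))

  ≈-sym : ∀ {x y} → x ≈ y → y ≈ x
  ≈-sym {x} {y} x≈y = ∣ₛ⇒≈ {y} {x} (∣m⇒∣-m (≈⇒∣ₛ {x} {y} x≈y)) (identity x y)
    where
    identity : ∀ x y → - (x - y) ≡ y - x
    identity = solve-∀

  ≈-trans : ∀ {x y z} → x ≈ y → y ≈ z → x ≈ z
  ≈-trans {x} {y} {z} x≈y y≈z = ∣ₛ⇒≈ {x} {z} (∣m∣n⇒∣m+n (≈⇒∣ₛ {x} {y} x≈y) (≈⇒∣ₛ {y} {z} y≈z)) (identity x y z)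
    where
    identity : ∀ x y z → (x - y) + (y - z) ≡ x - z
    identity = solve-∀

  +-cong : ∀ {x y u v} → x ≈ y → u ≈ v → x + u ≈ y + v
  +-cong {x} {y} {u} {v} x≈y u≈v = ∣ₛ⇒≈ {x + u} {y + v} (∣m∣n⇒∣m+n (≈⇒∣ₛ {x} {y} x≈y) (≈⇒∣ₛ {u} {v} u≈v)) (identity x y u v)
    where
    identity : ∀ x y u v → (x - y) + (u - v) ≡ (x + u) - (y + v)
    identity = solve-∀

  *-cong : ∀ {x y u v} → x ≈ y → u ≈ v → x * u ≈ y * v
  *-cong {x} {y} {u} {v} x≈y u≈v = ∣ₛ⇒≈ {x * u} {y * v}
    (∣m∣n⇒∣m+n (∣n⇒∣m*n x (≈⇒∣ₛ {u} {v} u≈v)) (∣m⇒∣m*n v (≈⇒∣ₛ {x} {y} x≈y))) (identity x y u v)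
    where
    identity : ∀ x y u v → x * (u - v) + (x - y) * v ≡ x * u - y * v
    identity = solve-∀

  -‿cong : ∀ {x y} → x ≈ y → - x ≈ - y
  -‿cong {x} {y} x≈y = ∣ₛ⇒≈ { - x} { - y} (∣m⇒∣-m (≈⇒∣ₛ {x} {y} x≈y)) (identity x y)
    where
    identity : ∀ x y → - (x - y) ≡ - x - - y
    identity = solve-∀

  ℤ/pℤ : CommutativeRing 0ℓ 0ℓ
  ℤ/pℤ = record
    { Carrier = ℤ ; _≈_ = _≈_ ; _+_ = _+_ ; _*_ = _*_ ; -_ = -_ ; 0# = ℤ.0ℤ ; 1# = ℤ.1ℤ
    ; isCommutativeRing = record
      { isRing = record
        { +-isAbelianGroup = record
          { isGroup = record
            { isMonoid = record
              { isSemigroup = record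
                { isMagma = record
                  { isEquivalence = record
                    { refl = λ {x} → ≈-reflexive {x} ≡.refl
                    ; sym = λ {x} {y} → ≈-sym {x} {y}
                    ; trans = λ {x} {y} {z} → ≈-trans {x} {y} {z} }
                  ; ∙-cong = λ {x} {y} {u} {v} → +-cong {x} {y} {u} {v} }
                ; assoc = λ x y z → ≈-reflexive (ℤₚ.+-assoc x y z) }
              ; identity = (≈-reflexive ∘ ℤₚ.+-identityˡ) , (≈-reflexive ∘ ℤₚ.+-identityʳ) }
            ; inverse = (≈-reflexive ∘ ℤₚ.+-inverseˡ) , (≈-reflexive ∘ ℤₚ.+-inverseʳ)
            ; ⁻¹-cong = λ {x} {y} → -‿cong {x} {y} }
          ; comm = λ x y → ≈-reflexive (ℤₚ.+-comm x y) }
        ; *-cong = λ {x} {y} {u} {v} → *-cong {x} {y} {u} {v}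
        ; *-assoc = λ x y z → ≈-reflexive (ℤₚ.*-assoc x y z)
        ; *-identity = (≈-reflexive ∘ ℤₚ.*-identityˡ) , (≈-reflexive ∘ ℤₚ.*-identityʳ)
        ; distrib = (λ x y z → ≈-reflexive (ℤₚ.*-distribˡ-+ x y z)) , (λ x y z → ≈-reflexive (ℤₚ.*-distribʳ-+ x y z)) }
      ; *-comm = λ x y → ≈-reflexive (ℤₚ.*-comm x y) } }

  private
    divisible-below-p : ∀ {d} → d ℕ.< p → p ∣ℕ d → d ≡ 0
    divisible-below-p {zero}  _   _   = ≡.refl
    divisible-below-p {suc d} d<p p∣d = ⊥-elim (ℕₚ.<⇒≱ d<p (ℕ∣.∣⇒≤ p∣d))

    residues-distinct : ∀ {a b} → a ℕ.< p → b ℕ.< p → + a ≈ + b → a ≡ b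
    residues-distinct {a} {b} a<p b<p p∣a-b with ℕₚ.≤-total b a
    ... | inj₁ b≤a = ℕₚ.≤-antisym (ℕₚ.m∸n≡0⇒m≤n (divisible-below-p (ℕₚ.≤-<-trans (ℕₚ.m∸n≤m a b) a<p)
                       (≡.subst (p ∣ℕ_) (≡.cong ℤ.∣_∣ (≡.trans (ℤₚ.m-n≡m⊖n a b) (ℤₚ.⊖-≥ b≤a))) p∣a-b))) b≤a
    ... | inj₂ a≤b = ℕₚ.≤-antisym a≤b (ℕₚ.m∸n≡0⇒m≤n (divisible-below-p (ℕₚ.≤-<-trans (ℕₚ.m∸n≤m b a) b<p)
                       (≡.subst (p ∣ℕ_) (≡.trans (≡.cong ℤ.∣_∣ (≡.trans (ℤₚ.m-n≡m⊖n a b) (ℤₚ.⊖-≤ a≤b)))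
                                                 (ℤₚ.∣-i∣≡∣i∣ (+ (b ℕ.∸ a)))) p∣a-b)))

  module _ (prime : Prime p) where
    private instance
      p≢0 : ℕ.NonZero p
      p≢0 = Primality.prime⇒nonZero prime

    ≈-residue : ∀ x → x ≈ + (x ℤ.%ℕ p)
    ≈-residue x = ∣ₛ⇒≈ {x} {+ (x ℤ.%ℕ p)} (divides (x ℤ./ℕ p) (cancel (ℤ.a≡a%ℕn+[a/ℕn]*n x p))) ≡.refl
      where
      cancel : ∀ {x r t} → x ≡ r + t → x - r ≡ t
      cancel {r = r} {t} ≡.refl = identity r t
        where
        identity : ∀ r t → (r + t) - r ≡ t
        identity = solve-∀

    inverse : ∀ x → ¬ x ≈ ℤ.0ℤ → ∃ λ y → x * y ≈ ℤ.1ℤ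
    inverse x x≉0 with coprime-Bézout (prime⇒coprime prime {{r≢0}} (ℤ.n%ℕd<d x p))
      where
      r≢0 : ℕ.NonZero (x ℤ.%ℕ p)
      r≢0 = ℕ.≢-nonZero λ r≡0 → x≉0 (≈-trans {x} {+ (x ℤ.%ℕ p)} {ℤ.0ℤ} (≈-residue x) (≈-reflexive (≡.cong +_ r≡0)))
    ... | Bézout.-+ k y 1+kp≡yr = + y , ∣ₛ⇒≈ {x * + y} {ℤ.1ℤ}
          (∣m∣n⇒∣m+n (∣m⇒∣m*n (+ y) (≈⇒∣ₛ {x} (≈-residue x))) (divides (+ k) ry-1≡kp)) (identity x (+ r) (+ y))
      where
      open ≡.≡-Reasoning
      r : ℕ
      r = x ℤ.%ℕ p
      ry-1≡kp : + r * + y - ℤ.1ℤ ≡ + k * + p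
      ry-1≡kp = begin
        + r * + y - ℤ.1ℤ           ≡⟨ ≡.cong (_- ℤ.1ℤ) (ℤₚ.pos-* r y) ⟨
        + (r ℕ.* y) - ℤ.1ℤ         ≡⟨ ≡.cong (λ n → + n - ℤ.1ℤ) (≡.trans (ℕₚ.*-comm r y) (≡.sym 1+kp≡yr)) ⟩
        + (1 ℕ.+ k ℕ.* p) - ℤ.1ℤ   ≡⟨ ≡.cong (_- ℤ.1ℤ) (ℤₚ.pos-+ 1 (k ℕ.* p)) ⟩
        (ℤ.1ℤ + + (k ℕ.* p)) - ℤ.1ℤ ≡⟨ cancel (+ (k ℕ.* p)) ⟩
        + (k ℕ.* p)                ≡⟨ ℤₚ.pos-* k p ⟩
        + k * + p                  ∎
        where
        cancel : ∀ n → (ℤ.1ℤ + n) - ℤ.1ℤ ≡ n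
        cancel = solve-∀
      identity : ∀ x r y → (x - r) * y + (r * y - ℤ.1ℤ) ≡ x * y - ℤ.1ℤ
      identity = solve-∀
    ... | Bézout.+- k y 1+yr≡kp = - + y , ∣ₛ⇒≈ {x * - + y} {ℤ.1ℤ}
          (∣m∣n⇒∣m+n (∣m⇒∣-m (∣m⇒∣m*n (+ y) (≈⇒∣ₛ {x} (≈-residue x)))) (∣m⇒∣-m (divides (+ k) ry+1≡kp)))
          (identity x (+ r) (+ y))
      where
      open ≡.≡-Reasoning
      r : ℕ
      r = x ℤ.%ℕ p
      ry+1≡kp : + r * + y + ℤ.1ℤ ≡ + k * + p
      ry+1≡kp = begin
        + r * + y + ℤ.1ℤ      ≡⟨ ≡.cong (_+ ℤ.1ℤ) (ℤₚ.pos-* r y) ⟨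
        + (r ℕ.* y) + ℤ.1ℤ    ≡⟨ ℤₚ.pos-+ (r ℕ.* y) 1 ⟨
        + (r ℕ.* y ℕ.+ 1)     ≡⟨ ≡.cong +_ (≡.trans (ℕₚ.+-comm (r ℕ.* y) 1) (≡.trans (≡.cong suc (ℕₚ.*-comm r y)) 1+yr≡kp)) ⟩
        + (k ℕ.* p)           ≡⟨ ℤₚ.pos-* k p ⟩
        + k * + p             ∎
      identity : ∀ x r y → - ((x - r) * y) + - (r * y + ℤ.1ℤ) ≡ x * - y - ℤ.1ℤ
      identity = solve-∀

    ℤ/pℤ-isFiniteField : IsFiniteField ℤ/pℤ p
    ℤ/pℤ-isFiniteField = record
      { 0≉1             = λ p∣1 → ℕ.nonTrivial⇒≢1 {{Primality.prime⇒nonTrivial prime}} (ℕ∣.∣1⇒≡1 p∣1)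
      ; inverse         = inverse
      ; _≟_             = λ x y → p ℕ∣.∣? ℤ.∣ x - y ∣
      ; enum            = λ i → + toℕ i
      ; enum-injective  = λ i j i≈j → Finₚ.toℕ-injective (residues-distinct (Finₚ.toℕ<n i) (Finₚ.toℕ<n j) i≈j)
      ; enum-surjective = λ x → Fin.fromℕ< (ℤ.n%ℕd<d x p) ,
          ≡.subst (λ r → + r ≈ x) (≡.sym (Finₚ.toℕ-fromℕ< (ℤ.n%ℕd<d x p))) (≈-sym {x} (≈-residue x))
      }

  char≢2 : p ℕ.% 4 ≡ 3 → CharNot2 ℤ/pℤ
  char≢2 p%4≡3 p∣2 = ℕₚ.<⇒≱ (3≤p p p%4≡3) (ℕ∣.∣⇒≤ p∣2)
    where
    3≤p : ∀ p → p ℕ.% 4 ≡ 3 → 3 ℕ.≤ p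
    3≤p (suc (suc (suc _))) _ = s≤s (s≤s (s≤s z≤n))

open import Data.Nat using (_∸_; _+_; _%_)
open import Data.Nat.Primality using (Prime)

proposition6p5 : ∀ {c ℓ : Level} →
    (∀ (K : CommutativeRing c ℓ) (q : ℕ) →
       IsFiniteField K q → CharNot2 K →
       EA.AtLeastHalfGood (CommutativeRing.rawRing K) (q ∸ 1))
    × (∀ (p : ℕ) → Prime p → p % 4 ≡ 3 →
       EA.AtLeastHalfGood (ℤmod p) (p + 1))
proposition6p5 =
  (λ K q finite char≠2 → GoodUnits.at-least-half-good K q finite char≠2) ,
  (λ p prime p%4≡3 → let open IntegersModulo p
                         finite : IsFiniteField ℤ/pℤ p
                         finite = ℤ/pℤ-isFiniteField prime
                         char≠2 : CharNot2 ℤ/pℤ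
                         char≠2 = char≢2 p%4≡3
                     in GoodUnits.at-least-half-good′ ℤ/pℤ p finite char≠2
                          (FiniteField.q≡3[mod4]⇒-1-nonsquare ℤ/pℤ p finite char≠2 p%4≡3))
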